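{- Let $n\ge 2$ and give $\Phi^+(D_n)$ the column structure $\mathrm{col}(e_i-e_j)=i+j$ and $\mathrm{col}(e_i+e_j)=2n-(j-i)$ for $1\le i<j\le n$. Let $t_1<t_2<\cdots<t_K$ be the values taken by $\mathrm{col}$, let $c_t$ be the product of the toggles of all elements with $\mathrm{col}=t$, and let $\mathrm{pro}=c_{t_K}\circ\cdots\circ c_{t_2}\circ c_{t_1}$ (so $c_{t_1}$ is applied first). Then there is a bijection $\Phi:J(\Phi^+(D_n))\to J(\Phi^+(D_n))$ with $\Phi\circ\mathrm{row}=\mathrm{pro}\circ\Phi$.
   Context: $\Phi^+(D_n)=\{e_i\pm e_j:1\le i<j\le n\}\subset\mathbb{R}^n$, partially ordered by $\alpha\le\beta$ iff $\beta-\alpha$ is a nonnegative integer combination of elements of $\Phi^+(D_n)$. $J(P)$ is the set of order ideals. Toggle $t_p$ on $J(P)$: $t_p(I)=I\cup\{p\}$ if $p\notin I$ and all $p'<p$ lie in $I$; $t_p(I)=I\setminus\{p\}$ if $p\in I$ and no $p'>p$ lies in $I$; $t_p(I)=I$ otherwise. Elements with equal $\mathrm{col}$ value are pairwise non-covering, so $c_t$ is well defined. Rowmotion: $\mathrm{row}(I)$ is the order ideal generated by the minimal elements of $P\setminus I$. -}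

module Defs where

open import Data.Nat using (ℕ; zero; suc; _+_; _*_; _∸_; _≟_)
import Data.Nat as ℕ
open import Data.Fin using (Fin; toℕ; _<_)
import Data.Fin as Fin
open import Data.Bool using (Bool; true; false; if_then_else_)
open import Data.Integer using (ℤ; 0ℤ; 1ℤ; -1ℤ)
import Data.Integer as ℤ
open import Data.List using (List; []; _∷_; map; concatMap; filter; allFin; upTo)
import Data.List as List
open import Data.Product using (Σ; ∃; ∃-syntax; _×_; _,_; proj₁; proj₂)
open import Relation.Nullary using (¬_; yes; no)
open import Relation.Nullary.Decidable using (⌊_⌋)
open import Relation.Binary.PropositionalEquality using (_≡_; _≢_)

-- The positive roots of D_n.  A root is e_i - e_j (sign = false) or
-- e_i + e_j (sign = true) with i < j.  Indices are 0-based Fin n here,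
-- i.e. the paper's index i corresponds to toℕ i + 1.

record Root (n : ℕ) : Set where
  constructor root
  field
    i    : Fin n
    j    : Fin n
    i<j  : i < j
    plus : Bool

open Root public

δ : ∀ {n} → Fin n → Fin n → ℤ
δ a k = if ⌊ a Fin.≟ k ⌋ then 1ℤ else 0ℤ

vec : ∀ {n} → Root n → Fin n → ℤ
vec r k = δ (i r) k ℤ.+ (if plus r then δ (j r) k else ℤ.- δ (j r) k)

-- α ≤ β iff β - α is a nonnegative integer combination of positive roots,
-- i.e. a sum of a finite list (multiset) of positive roots.
_≤R_ : ∀ {n} → Root n → Root n → Set
_≤R_ {n} α β = ∃[ xs ] ((k : Fin n) →
  vec β k ≡ vec α k ℤ.+ List.foldr ℤ._+_ 0ℤ (map (λ r → vec r k) xs))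

_<R_ : ∀ {n} → Root n → Root n → Set
α <R β = α ≤R β × α ≢ β

col : ∀ {n} → Root n → ℕ
col {n} r with plus r
... | false = suc (toℕ (i r)) + suc (toℕ (j r))
... | true  = (2 * n) ∸ (toℕ (j r) ∸ toℕ (i r))

Subset : ℕ → Set
Subset n = Root n → Bool

_≈_ : ∀ {n} → Subset n → Subset n → Set
A ≈ B = ∀ q → A q ≡ B q

IsIdeal : ∀ {n} → Subset n → Set
IsIdeal {n} I = (p q : Root n) → p ≤R q → I q ≡ true → I p ≡ true

J : ℕ → Set
J n = Σ (Subset n) IsIdeal

_≈J_ : ∀ {n} → J n → J n → Set
I ≈J I' = proj₁ I ≈ proj₁ I'

Toggle : ∀ {n} → Root n → Subset n → Subset n → Set
Toggle {n} p I I' =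
  ((q : Root n) → q ≢ p → I' q ≡ I q) ×
  ((I' p ≡ true) →
     ((I p ≡ true × ∃[ p' ] (p <R p' × I p' ≡ true)) ⊎
      (I p ≡ false × ((p' : Root n) → p' <R p → I p' ≡ true)))) ×
  (((I p ≡ true × ∃[ p' ] (p <R p' × I p' ≡ true)) ⊎
      (I p ≡ false × ((p' : Root n) → p' <R p → I p' ≡ true))) →
     I' p ≡ true)
  where open import Data.Sum using (_⊎_)

Toggles : ∀ {n} → List (Root n) → Subset n → Subset n → Set
Toggles []       I I' = I ≈ I'
Toggles (p ∷ ps) I I' = ∃[ I₁ ] (Toggle p I I₁ × Toggles ps I₁ I')

pairRoots : ∀ {n} → Fin n → Fin n → List (Root n)
pairRoots a b with a Fin.<? b
... | yes a<b = root a b a<b false ∷ root a b a<b true ∷ []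
... | no  _   = []

allRoots : (n : ℕ) → List (Root n)
allRoots n = concatMap (λ a → concatMap (λ b → pairRoots a b) (allFin n)) (allFin n)

column : (n t : ℕ) → List (Root n)
column n t = filter (λ r → col r ≟ t) (allRoots n)

-- All col values lie in {0,…,2n-1}; toggling an empty column is the
-- identity, so this is c_{t_K} ∘ ⋯ ∘ c_{t_1} (c_{t_1} applied first).
proOrder : (n : ℕ) → List (Root n)
proOrder n = concatMap (column n) (upTo (2 * n))

Pro : ∀ {n} → Subset n → Subset n → Set
Pro {n} = Toggles (proOrder n)

MinimalOutside : ∀ {n} → Subset n → Root n → Set
MinimalOutside I m = I m ≡ false × ¬ (∃[ m' ] (m' <R m × I m' ≡ false))

Row : ∀ {n} → Subset n → Subset n → Set
Row {n} I I' = (q : Root n) →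
  (I' q ≡ true → ∃[ m ] (MinimalOutside I m × q ≤R m)) ×
  (∃[ m ] (MinimalOutside I m × q ≤R m) → I' q ≡ true)

-- Toggling a layer {x | f x = t} of a function f that changes by exactly one along every cover
-- is well defined, since no two elements of a layer are adjacent; for f = col this is c_t, so pro
-- sweeps the col-layers t = 0, 1, ….  The function depth = 4n − height (height e_a − e_b = b − a,
-- height e_a + e_b = 2n − a − b − 2, indices from 0) also changes by one along covers and
-- decreases strictly upwards, so sweeping its layers from 0 upwards is rowmotion
-- (Cameron–Fon-der-Flaass).  Moreover depth = col + 2·excess with excess ≥ 0.  While excess ≠ 0,
-- a point v with positive excess and least col is a local minimum of col (all its neighbours lie
-- one column higher); raising col by 2 at v moves v from layer a to layer a + 2, and since v is
-- adjacent only to layer a + 1 this conjugates the sweep by the toggle at v.  Composing these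
-- toggles gives Φ.  The order on Φ⁺(D_n) is made explicit by testing against weights that are
-- nonnegative on positive roots; its covers are the additions of a simple root.

module Submission where

open import Defs
  using (Root; root; i; j; i<j; plus; δ; vec; _≤R_; col; pairRoots; allRoots; proOrder; J; _≈J_; Row; Pro; Toggles)

open import Data.Bool using (Bool; true; false; if_then_else_)
open import Data.Bool.Properties using (¬-not)
import Data.Bool as Bool
open import Data.Empty using (⊥; ⊥-elim)
open import Data.Fin as Fin using (Fin; toℕ)
import Data.Fin.Properties as Fin
open import Data.Integer as ℤ using (ℤ; 0ℤ; 1ℤ; -1ℤ)
import Data.Integer.Properties as ℤ
open import Data.Integer.Tactic.RingSolver using (solve-∀)
open import Data.Nat.Tactic.RingSolver using () renaming (solve-∀ to ℕ-solve-∀)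
open import Data.List using (List; []; _∷_; _++_; filter; map; applyUpTo; upTo; concatMap)
open import Data.Nat.ListAction using (sum)
open import Data.List.Membership.Propositional using (_∈_)
open import Data.List.Membership.Propositional.Properties
  using (∈-filter⁻; ∈-filter⁺; ∈-concat⁺′; ∈-concat⁻′; ∈-map⁺; ∈-map⁻; ∈-allFin)
import Data.List.Membership.DecPropositional as DecMembership
import Data.List.Relation.Unary.All as All
open import Data.List.Relation.Unary.All.Properties using (all-filter)
import Data.List.Relation.Unary.All.Properties as All
open import Data.List.Extrema.Nat using (argmin; argmin-all; f[argmin]≤f[xs])
open import Data.List.Relation.Unary.AllPairs using (_∷_)
open import Data.List.Relation.Unary.Any as Any using (here; there)
open import Data.List.Relation.Unary.Unique.Propositional using (Unique)
open import Data.List.Relation.Unary.Unique.Propositional.Properties using (filter⁺; Unique[x∷xs]⇒x∉xs)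
import Data.List.Relation.Unary.Unique.Propositional.Properties as Unique
import Data.List.Relation.Unary.AllPairs as AllPairs
import Data.List.Relation.Unary.AllPairs.Properties as AllPairs
open import Data.Nat as ℕ using (ℕ; zero; suc; _+_; _∸_; _*_; _≤_)
import Data.Nat.Properties as ℕ
open import Data.Product using (Σ; ∃; _×_; _,_; proj₁; proj₂)
open import Data.Sum using (_⊎_; inj₁; inj₂)
open import Function using (_∘_; case_of_)
open import Level using (0ℓ)
open import Relation.Binary using (Rel; IsDecPartialOrder; DecidableEquality; tri<; tri≈; tri>)
import Relation.Binary.Construct.NonStrictToStrict as NonStrictToStrict
open import Relation.Binary.PropositionalEquality
  using (_≡_; _≢_; refl; sym; trans; cong; cong₂; subst; subst₂; _≗_; ≢-sym; module ≡-Reasoning)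
import Relation.Binary.PropositionalEquality as Eq
open import Relation.Nullary using (¬_; Dec; yes; no; does; _×-dec_; _→-dec_)
open import Relation.Nullary.Decidable using (dec-true; dec-false; True; toWitness)
import Relation.Nullary.Decidable as Dec

does-true : ∀ {A : Set} (a? : Dec A) → does a? ≡ true → A
does-true (yes a) _ = a

does-false : ∀ {A : Set} (a? : Dec A) → does a? ≡ false → ¬ A
does-false (no ¬a) _ = ¬a

does-⇔ : ∀ {A B : Set} (a? : Dec A) (b? : Dec B) → (A → B) → (B → A) → does a? ≡ does b?
does-⇔ (yes _) (yes _) _ _ = refl
does-⇔ (yes a) (no ¬b) f _ = ⊥-elim (¬b (f a))
does-⇔ (no ¬a) (yes b) _ g = ⊥-elim (¬a (g b))
does-⇔ (no _) (no _) _ _ = refl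

true≢false : true ≢ false
true≢false ()

range : ℕ → ℕ → List ℕ
range s zero = []
range s (suc k) = s ∷ range (suc s) k

range-++ : ∀ s k l → range s (k + l) ≡ range s k ++ range (s + k) l
range-++ s zero l rewrite ℕ.+-identityʳ s = refl
range-++ s (suc k) l rewrite ℕ.+-suc s k = cong (s ∷_) (range-++ (suc s) k l)

range-∷ʳ : ∀ s k → range s (suc k) ≡ range s k ++ (s + k ∷ [])
range-∷ʳ s k = trans (cong (range s) (ℕ.+-comm 1 k)) (range-++ s k 1)

∈-range : ∀ {s k t} → t ∈ range s k → s ℕ.≤ t × t ℕ.< s + k
∈-range {s} {suc k} (here refl) = ℕ.≤-refl , ℕ.m<m+n s (ℕ.s≤s ℕ.z≤n)
∈-range {s} {suc k} {t} (there t∈) with ∈-range t∈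
... | s<t , t<s+k = ℕ.<⇒≤ s<t , subst (t ℕ.<_) (sym (ℕ.+-suc s k)) t<s+k

applyUpTo≡range : ∀ s k → applyUpTo (s +_) k ≡ range s k
applyUpTo≡range s zero = refl
applyUpTo≡range s (suc k) =
  cong₂ _∷_ (ℕ.+-identityʳ s) (trans (applyUpTo-cong (λ i → ℕ.+-suc s i) k) (applyUpTo≡range (suc s) k))
  where
  applyUpTo-cong : ∀ {f g : ℕ → ℕ} → (∀ i → f i ≡ g i) → ∀ k → applyUpTo f k ≡ applyUpTo g k
  applyUpTo-cong f≗g zero = refl
  applyUpTo-cong f≗g (suc k) = cong₂ _∷_ (f≗g 0) (applyUpTo-cong (f≗g ∘ suc) k)

sum-map-≤ : ∀ {A : Set} {e e′ : A → ℕ} xs → (∀ y → e′ y ℕ.≤ e y) → sum (map e′ xs) ℕ.≤ sum (map e xs)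
sum-map-≤ [] _ = ℕ.z≤n
sum-map-≤ (y ∷ xs) e′≤e = ℕ.+-mono-≤ (e′≤e y) (sum-map-≤ xs e′≤e)

sum-map-< : ∀ {A : Set} {e e′ : A → ℕ} {x} xs → (∀ y → e′ y ℕ.≤ e y) → x ∈ xs → e′ x ℕ.< e x →
            sum (map e′ xs) ℕ.< sum (map e xs)
sum-map-< (y ∷ xs) e′≤e (here refl) lt = ℕ.+-mono-<-≤ lt (sum-map-≤ xs e′≤e)
sum-map-< (y ∷ xs) e′≤e (there x∈) lt = ℕ.+-mono-≤-< (e′≤e y) (sum-map-< xs e′≤e x∈ lt)

≤-sum-map : ∀ {A : Set} (e : A → ℕ) {x} {xs} → x ∈ xs → e x ℕ.≤ sum (map e xs)
≤-sum-map e {xs = y ∷ xs} (here refl) = ℕ.m≤m+n (e y) _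
≤-sum-map e {xs = y ∷ xs} (there x∈) = ℕ.≤-trans (≤-sum-map e x∈) (ℕ.m≤n+m _ (e y))

positive-gap : ∀ {m n k} → n ≡ m + 2 * k → 0 ℕ.< k → suc (suc m) ℕ.≤ n
positive-gap {m} {k = k} refl k>0 = subst (ℕ._≤ m + 2 * k) (ℕ.+-comm m 2) (ℕ.+-monoʳ-≤ m (ℕ.*-monoʳ-≤ 2 k>0))

pred< : ∀ {n} → 0 ℕ.< n → ℕ.pred n ℕ.< n
pred< {suc n} _ = ℕ.n<1+n n

outside-window : ∀ {a t} → t ℕ.< a ⊎ suc (suc a) ℕ.< t → t ≢ a × t ≢ suc a × t ≢ suc (suc a)
outside-window (inj₁ t<a) = ℕ.<⇒≢ t<a , ℕ.<⇒≢ (ℕ.m<n⇒m<1+n t<a) , ℕ.<⇒≢ (ℕ.m<n⇒m<1+n (ℕ.m<n⇒m<1+n t<a))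
outside-window (inj₂ 2+a<t) = ℕ.>⇒≢ (ℕ.<⇒≤ (ℕ.<⇒≤ 2+a<t)) , ℕ.>⇒≢ (ℕ.<⇒≤ 2+a<t) , ℕ.>⇒≢ 2+a<t

+-twice-suc : ∀ m k → m + 2 * suc k ≡ suc (suc m) + 2 * k
+-twice-suc m k = trans (cong (m +_) (ℕ.*-suc 2 k)) (trans (sym (ℕ.+-assoc m 2 (2 * k))) (cong (_+ 2 * k) (ℕ.+-comm m 2)))

∈-concatMap⁺ : ∀ {A B : Set} (F : A → List B) {x y xs} → x ∈ xs → y ∈ F x → y ∈ concatMap F xs
∈-concatMap⁺ F x∈xs y∈Fx = ∈-concat⁺′ y∈Fx (∈-map⁺ F x∈xs)

∈-concatMap⁻ : ∀ {A B : Set} (F : A → List B) {y} xs → y ∈ concatMap F xs → ∃ λ x → x ∈ xs × y ∈ F x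
∈-concatMap⁻ F {y} xs y∈ with ∈-concat⁻′ (map F xs) y∈
... | ys , y∈ys , ys∈ with ∈-map⁻ F ys∈
...   | x , x∈xs , refl = x , x∈xs , y∈ys

concatMap-unique : ∀ {A B : Set} (F : A → List B) {xs} → Unique xs → (∀ x → Unique (F x)) →
                   (∀ {x x′ y} → y ∈ F x → y ∈ F x′ → x ≡ x′) → Unique (concatMap F xs)
concatMap-unique F unique-xs unique-F separated = Unique.concat⁺
  (All.map⁺ (All.tabulate λ {x} _ → unique-F x))
  (AllPairs.map⁺ (AllPairs.map (λ x≢x′ {_} (y∈ , y∈′) → x≢x′ (separated y∈ y∈′)) unique-xs))

module FinitePoset
  {P : Set} {_≤_ : Rel P 0ℓ} (isDecPartialOrder : IsDecPartialOrder _≡_ _≤_)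
  (elements : List P) (∈-elements : ∀ x → x ∈ elements) (elements-unique : Unique elements)
  where

  open IsDecPartialOrder isDecPartialOrder
    using (_≟_; _≤?_) renaming (refl to ≤-refl; trans to ≤-trans)
  open NonStrictToStrict _≡_ _≤_ public using (_<_)
  open NonStrictToStrict _≡_ _≤_ using (<-decidable)

  _<?_ : ∀ x y → Dec (x < y)
  _<?_ = <-decidable _≟_ _≤?_

  <-irrefl : ∀ {x} → ¬ x < x
  <-irrefl (_ , x≢x) = x≢x refl

  ∃? : {Q : P → Set} → (∀ x → Dec (Q x)) → Dec (∃ Q)
  ∃? Q? = Dec.map′ Any.satisfied (λ (x , q) → Any.map (λ { refl → q }) (∈-elements x)) (Any.any? Q? elements)

  ∀? : {Q : P → Set} → (∀ x → Dec (Q x)) → Dec (∀ x → Q x)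
  ∀? Q? = Dec.map′ (λ all x → All.lookup all (∈-elements x)) (λ q → All.tabulate (λ {x} _ → q x)) (All.all? Q? elements)

  Subset : Set
  Subset = P → Bool

  IsIdeal : Subset → Set
  IsIdeal I = ∀ p q → p ≤ q → I q ≡ true → I p ≡ true

  hasAbove : Subset → P → Bool
  hasAbove I p = does (∃? λ q → (p <? q) ×-dec (I q Bool.≟ true))

  allBelow : Subset → P → Bool
  allBelow I p = does (∀? λ q → (q <? p) →-dec (I q Bool.≟ true))

  hasAbove-intro : ∀ I {p q} → p < q → I q ≡ true → hasAbove I p ≡ true
  hasAbove-intro I {q = q} p<q Iq = dec-true (∃? _) (q , p<q , Iq)

  hasAbove-elim : ∀ I {p} → hasAbove I p ≡ true → ∃ λ q → p < q × I q ≡ true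
  hasAbove-elim I = does-true (∃? _)

  hasAbove-false : ∀ I {p q} → hasAbove I p ≡ false → p < q → I q ≡ false
  hasAbove-false I {q = q} ¬above p<q = ¬-not λ Iq → does-false (∃? _) ¬above (q , p<q , Iq)

  hasAbove-cong : ∀ {I J p} → (∀ q → p < q → I q ≡ J q) → hasAbove I p ≡ hasAbove J p
  hasAbove-cong agree = does-⇔ (∃? _) (∃? _)
    (λ (q , p<q , Iq) → q , p<q , trans (sym (agree q p<q)) Iq)
    (λ (q , p<q , Jq) → q , p<q , trans (agree q p<q) Jq)

  allBelow-intro : ∀ I {p} → (∀ q → q < p → I q ≡ true) → allBelow I p ≡ true
  allBelow-intro I below = dec-true (∀? _) below

  allBelow-elim : ∀ I {p} → allBelow I p ≡ true → ∀ q → q < p → I q ≡ true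
  allBelow-elim I = does-true (∀? _)

  allBelow-false : ∀ I {p q} → q < p → I q ≡ false → allBelow I p ≡ false
  allBelow-false I {q = q} q<p Iq = dec-false (∀? _) λ below → true≢false (trans (sym (below q q<p)) Iq)

  allBelow-cong : ∀ {I J p} → (∀ q → q < p → I q ≡ J q) → allBelow I p ≡ allBelow J p
  allBelow-cong agree = does-⇔ (∀? _) (∀? _)
    (λ below q q<p → trans (sym (agree q q<p)) (below q q<p))
    (λ below q q<p → trans (agree q q<p) (below q q<p))

  hasAbove-both : ∀ {I J q r} → q < r → I r ≡ true → J r ≡ true → hasAbove I q ≡ hasAbove J q
  hasAbove-both q<r Ir Jr = trans (hasAbove-intro _ q<r Ir) (sym (hasAbove-intro _ q<r Jr))

  allBelow-both : ∀ {I J q r} → r < q → I r ≡ false → J r ≡ false → allBelow I q ≡ allBelow J q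
  allBelow-both r<q Ir Jr = trans (allBelow-false _ r<q Ir) (sym (allBelow-false _ r<q Jr))

  toggledValue : Subset → P → Bool
  toggledValue I p = if I p then hasAbove I p else allBelow I p

  toggledValue-cong : ∀ {I J} → I ≗ J → ∀ p → toggledValue I p ≡ toggledValue J p
  toggledValue-cong {I} {J} I≗J p
    rewrite I≗J p | hasAbove-cong {I} {J} {p} (λ q _ → I≗J q) | allBelow-cong {I} {J} {p} (λ q _ → I≗J q) = refl

  toggle : P → Subset → Subset
  toggle p I x = if does (x ≟ p) then toggledValue I p else I x

  toggle-self : ∀ p I → toggle p I p ≡ toggledValue I p
  toggle-self p I rewrite dec-true (p ≟ p) refl = refl

  toggle-other : ∀ p I {x} → x ≢ p → toggle p I x ≡ I x
  toggle-other p I {x} x≢p rewrite dec-false (x ≟ p) x≢p = refl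

  toggle-cong : ∀ p {I J} → I ≗ J → toggle p I ≗ toggle p J
  toggle-cong p I≗J x with does (x ≟ p)
  ... | true = toggledValue-cong I≗J p
  ... | false = I≗J x

  data ToggleCase (I : Subset) (p : P) : Set where
    unchanged : toggledValue I p ≡ I p → ToggleCase I p
    removed   : I p ≡ true → hasAbove I p ≡ false → ToggleCase I p
    added     : I p ≡ false → allBelow I p ≡ true → ToggleCase I p

  toggledValue-in : ∀ {I p} → I p ≡ true → toggledValue I p ≡ hasAbove I p
  toggledValue-in {I} {p} Ip rewrite Ip = refl

  toggledValue-out : ∀ {I p} → I p ≡ false → toggledValue I p ≡ allBelow I p
  toggledValue-out {I} {p} Ip rewrite Ip = refl

  InAfterToggle : Subset → P → Set
  InAfterToggle I p =
    (I p ≡ true × ∃ λ p′ → p < p′ × I p′ ≡ true) ⊎ (I p ≡ false × (∀ p′ → p′ < p → I p′ ≡ true))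

  toggle-self-true : ∀ p I → toggle p I p ≡ true → InAfterToggle I p
  toggle-self-true p I Kp = byCase (I p) refl
    where
    Tp : toggledValue I p ≡ true
    Tp = trans (sym (toggle-self p I)) Kp
    byCase : ∀ b → I p ≡ b → InAfterToggle I p
    byCase true Ip = inj₁ (Ip , hasAbove-elim I (trans (sym (toggledValue-in Ip)) Tp))
    byCase false Ip = inj₂ (Ip , allBelow-elim I (trans (sym (toggledValue-out Ip)) Tp))

  toggle-self-true⁻¹ : ∀ p I → InAfterToggle I p → toggle p I p ≡ true
  toggle-self-true⁻¹ p I (inj₁ (Ip , p′ , p<p′ , Ip′)) =
    trans (toggle-self p I) (trans (toggledValue-in Ip) (hasAbove-intro I p<p′ Ip′))
  toggle-self-true⁻¹ p I (inj₂ (Ip , below)) =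
    trans (toggle-self p I) (trans (toggledValue-out Ip) (allBelow-intro I below))

  toggleCase : ∀ I p → ToggleCase I p
  toggleCase I p with I p in Ip | hasAbove I p in above | allBelow I p in below
  ... | true  | true  | _     = unchanged (trans (toggledValue-in Ip) (trans above (sym Ip)))
  ... | true  | false | _     = removed Ip above
  ... | false | _     | false = unchanged (trans (toggledValue-out Ip) (trans below (sym Ip)))
  ... | false | _     | true  = added Ip below

  toggle-unchanged : ∀ {p I} → toggledValue I p ≡ I p → toggle p I ≗ I
  toggle-unchanged {p} {I} e x with x ≟ p
  ... | yes refl = e
  ... | no _ = refl

  toggle-removed : ∀ {p I} → I p ≡ true → hasAbove I p ≡ false → toggle p I p ≡ false
  toggle-removed {p} {I} Ip above = trans (toggle-self p I) (trans (toggledValue-in Ip) above)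

  toggle-added : ∀ {p I} → I p ≡ false → allBelow I p ≡ true → toggle p I p ≡ true
  toggle-added {p} {I} Ip below = trans (toggle-self p I) (trans (toggledValue-out Ip) below)

  toggledValue-above : ∀ {I p q} → IsIdeal I → p < q → I q ≡ true → toggledValue I p ≡ true
  toggledValue-above {I} {p} {q} isIdeal p<q Iq with I p in Ip
  ... | true  = hasAbove-intro I p<q Iq
  ... | false = ⊥-elim (true≢false (trans (sym (isIdeal p q (proj₁ p<q) Iq)) Ip))

  toggledValue-below : ∀ {I p q} → IsIdeal I → q < p → toggledValue I p ≡ true → I q ≡ true
  toggledValue-below {I} {p} {q} isIdeal q<p Kp with I p in Ip
  ... | true  = isIdeal q p (proj₁ q<p) Ip
  ... | false = allBelow-elim I Kp q q<p

  toggle-isIdeal : ∀ p {I} → IsIdeal I → IsIdeal (toggle p I)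
  toggle-isIdeal p {I} isIdeal x y x≤y Ky with x ≟ p | y ≟ p
  ... | yes refl | yes refl = Ky
  ... | yes refl | no y≢p   =
    toggledValue-above isIdeal (x≤y , ≢-sym y≢p) Ky
  ... | no x≢p   | yes refl = toggledValue-below isIdeal (x≤y , x≢p) Ky
  ... | no _     | no _     = isIdeal x y x≤y Ky

  toggle-involutive : ∀ p {I} → IsIdeal I → toggle p (toggle p I) ≗ I
  toggle-involutive p {I} isIdeal x with x ≟ p
  ... | no _     = refl
  ... | yes refl = restore (toggleCase I p)
    where
    restore : ToggleCase I p → toggledValue (toggle p I) p ≡ I p
    restore (unchanged e) = trans (toggledValue-cong (toggle-unchanged e) p) e
    restore (removed Ip above) = trans (toggledValue-out (toggle-removed Ip above)) (trans
      (allBelow-intro _ λ q q<p → trans (toggle-other p I (proj₂ q<p)) (isIdeal q p (proj₁ q<p) Ip))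
      (sym Ip))
    restore (added Ip below) = trans (toggledValue-in (toggle-added Ip below)) (trans
      (¬-not λ above → let (q , p<q , Kq) = hasAbove-elim _ above in
        true≢false (trans (sym (isIdeal p q (proj₁ p<q) (trans (sym (toggle-other p I (≢-sym (proj₂ p<q)))) Kq))) Ip))
      (sym Ip))

  Cover : P → P → Set
  Cover p q = p < q × ¬ (∃ λ r → p < r × r < q)

  Adjacent : P → P → Set
  Adjacent p q = Cover p q ⊎ Cover q p

  between : ∀ {p q} → p < q → ¬ Cover p q → ∃ λ r → p < r × r < q
  between {p} {q} p<q ¬cover with ∃? (λ r → (p <? r) ×-dec (r <? q))
  ... | yes r = r
  ... | no ¬r = ⊥-elim (¬cover (p<q , ¬r))

  hasAbove-toggle : ∀ {I} → IsIdeal I → ∀ {p q} → ¬ Adjacent p q → hasAbove (toggle p I) q ≡ hasAbove I q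
  hasAbove-toggle {I} isIdeal {p} {q} ¬adj with q <? p
  ... | no ¬q<p = hasAbove-cong λ r q<r → toggle-other p I λ { refl → ¬q<p q<r }
  ... | yes q<p with between q<p (¬adj ∘ inj₂) | toggleCase I p
  ...   | _ | unchanged e = hasAbove-cong λ r _ → toggle-unchanged e r
  ...   | r , q<r , r<p | removed Ip _ =
    hasAbove-both q<r (trans (toggle-other p I (proj₂ r<p)) Ir) Ir
    where
    Ir : I r ≡ true
    Ir = isIdeal r p (proj₁ r<p) Ip
  ...   | r , q<r , r<p | added _ below =
    hasAbove-both q<r (trans (toggle-other p I (proj₂ r<p)) Ir) Ir
    where
    Ir : I r ≡ true
    Ir = allBelow-elim I below r r<p

  allBelow-toggle : ∀ {I} → IsIdeal I → ∀ {p q} → ¬ Adjacent p q → allBelow (toggle p I) q ≡ allBelow I q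
  allBelow-toggle {I} isIdeal {p} {q} ¬adj with p <? q
  ... | no ¬p<q = allBelow-cong λ r r<q → toggle-other p I λ { refl → ¬p<q r<q }
  ... | yes p<q with between p<q (¬adj ∘ inj₁) | toggleCase I p
  ...   | _ | unchanged e = allBelow-cong λ r _ → toggle-unchanged e r
  ...   | r , p<r , r<q | removed _ above =
    allBelow-both r<q (trans (toggle-other p I (≢-sym (proj₂ p<r))) Ir) Ir
    where
    Ir : I r ≡ false
    Ir = hasAbove-false I above p<r
  ...   | r , p<r , r<q | added Ip _ =
    allBelow-both r<q (trans (toggle-other p I (≢-sym (proj₂ p<r))) Ir) Ir
    where
    Ir : I r ≡ false
    Ir = ¬-not λ Ir → true≢false (trans (sym (isIdeal p r (proj₁ p<r) Ir)) Ip)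

  toggledValue-toggle : ∀ {I} → IsIdeal I → ∀ {p q} → q ≢ p → ¬ Adjacent p q →
                        toggledValue (toggle p I) q ≡ toggledValue I q
  toggledValue-toggle {I} isIdeal {p} {q} q≢p ¬adj
    rewrite toggle-other p I q≢p | hasAbove-toggle isIdeal ¬adj | allBelow-toggle isIdeal ¬adj = refl

  toggles : List P → Subset → Subset
  toggles [] I = I
  toggles (p ∷ ps) I = toggles ps (toggle p I)

  toggles⁻¹ : List P → Subset → Subset
  toggles⁻¹ [] I = I
  toggles⁻¹ (p ∷ ps) I = toggle p (toggles⁻¹ ps I)

  toggles-cong : ∀ ps {I J} → I ≗ J → toggles ps I ≗ toggles ps J
  toggles-cong [] I≗J = I≗J
  toggles-cong (p ∷ ps) I≗J = toggles-cong ps (toggle-cong p I≗J)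

  toggles⁻¹-cong : ∀ ps {I J} → I ≗ J → toggles⁻¹ ps I ≗ toggles⁻¹ ps J
  toggles⁻¹-cong [] I≗J = I≗J
  toggles⁻¹-cong (p ∷ ps) I≗J = toggle-cong p (toggles⁻¹-cong ps I≗J)

  toggles-isIdeal : ∀ ps {I} → IsIdeal I → IsIdeal (toggles ps I)
  toggles-isIdeal [] isIdeal = isIdeal
  toggles-isIdeal (p ∷ ps) isIdeal = toggles-isIdeal ps (toggle-isIdeal p isIdeal)

  toggles⁻¹-isIdeal : ∀ ps {I} → IsIdeal I → IsIdeal (toggles⁻¹ ps I)
  toggles⁻¹-isIdeal [] isIdeal = isIdeal
  toggles⁻¹-isIdeal (p ∷ ps) isIdeal = toggle-isIdeal p (toggles⁻¹-isIdeal ps isIdeal)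

  toggles-inverseˡ : ∀ ps {I} → IsIdeal I → toggles ps (toggles⁻¹ ps I) ≗ I
  toggles-inverseˡ [] _ _ = refl
  toggles-inverseˡ (p ∷ ps) isIdeal x =
    trans (toggles-cong ps (toggle-involutive p (toggles⁻¹-isIdeal ps isIdeal)) x) (toggles-inverseˡ ps isIdeal x)

  toggles-inverseʳ : ∀ ps {I} → IsIdeal I → toggles⁻¹ ps (toggles ps I) ≗ I
  toggles-inverseʳ [] _ _ = refl
  toggles-inverseʳ (p ∷ ps) isIdeal x =
    trans (toggle-cong p (toggles-inverseʳ ps (toggle-isIdeal p isIdeal)) x) (toggle-involutive p isIdeal x)

  toggles-++ : ∀ ps qs I → toggles (ps ++ qs) I ≡ toggles qs (toggles ps I)
  toggles-++ [] qs I = refl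
  toggles-++ (p ∷ ps) qs I = toggles-++ ps qs (toggle p I)

  toggledValue-toggles : ∀ {I} → IsIdeal I → ∀ {q} ps → (∀ {p} → p ∈ ps → q ≢ p × ¬ Adjacent p q) →
                         toggledValue (toggles ps I) q ≡ toggledValue I q
  toggledValue-toggles isIdeal [] _ = refl
  toggledValue-toggles isIdeal (p ∷ ps) far = trans
    (toggledValue-toggles (toggle-isIdeal p isIdeal) ps (far ∘ there))
    (toggledValue-toggle isIdeal (proj₁ (far (here refl))) (proj₂ (far (here refl))))

  toggleSet : Subset → Subset → Subset
  toggleSet S I x = if S x then toggledValue I x else I x

  NonAdjacent : Subset → Set
  NonAdjacent S = ∀ {x y} → S x ≡ true → S y ≡ true → ¬ Adjacent x y

  toggleSet-cong : ∀ S {I J} → I ≗ J → toggleSet S I ≗ toggleSet S J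
  toggleSet-cong S I≗J x with S x
  ... | true = toggledValue-cong I≗J x
  ... | false = I≗J x

  toggleSet-congˡ : ∀ {S T} → S ≗ T → ∀ I → toggleSet S I ≗ toggleSet T I
  toggleSet-congˡ S≗T I x rewrite S≗T x = refl

  open DecMembership _≟_ using (_∈?_)

  member : List P → Subset
  member ps x = does (x ∈? ps)

  member-other : ∀ ps {p x} → x ≢ p → member (p ∷ ps) x ≡ member ps x
  member-other ps {p} {x} x≢p rewrite dec-false (x ≟ p) x≢p = refl

  toggles-nonAdjacent : ∀ {ps} → Unique ps → (∀ {x y} → x ∈ ps → y ∈ ps → ¬ Adjacent x y) →
                        ∀ {I} → IsIdeal I → toggles ps I ≗ toggleSet (member ps) I
  toggles-nonAdjacent {[]} _ _ _ _ = refl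
  toggles-nonAdjacent {p ∷ ps} unique@(_ ∷ unique′) nonAdj {I} isIdeal x =
    trans (toggles-nonAdjacent unique′ (λ x∈ y∈ → nonAdj (there x∈) (there y∈)) (toggle-isIdeal p isIdeal) x) (shift (x ≟ p))
    where
    shift : Dec (x ≡ p) → toggleSet (member ps) (toggle p I) x ≡ toggleSet (member (p ∷ ps)) I x
    shift (yes refl)
      rewrite dec-false (p ∈? ps) (Unique[x∷xs]⇒x∉xs unique) | dec-true (p ≟ p) refl = refl
    shift (no x≢p) rewrite member-other ps x≢p with member ps x in x∈ps
    ... | true  = toggledValue-toggle isIdeal x≢p (nonAdj (here refl) (there (does-true (x ∈? ps) x∈ps)))
    ... | false = toggle-other p I x≢p

  toggles-filter : ∀ {Q : P → Set} (Q? : ∀ x → Dec (Q x)) → NonAdjacent (does ∘ Q?) →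
                   ∀ {I} → IsIdeal I → toggles (filter Q? elements) I ≗ toggleSet (does ∘ Q?) I
  toggles-filter {Q} Q? nonAdj isIdeal x = trans
    (toggles-nonAdjacent (filter⁺ Q? elements-unique) (λ x∈ y∈ → nonAdj (dec-true (Q? _) (in-Q x∈)) (dec-true (Q? _) (in-Q y∈)))
       isIdeal x)
    (toggleSet-congˡ (λ y → does-⇔ (y ∈? _) (Q? y) in-Q (∈-filter⁺ Q? (∈-elements y))) _ x)
    where
    in-Q : ∀ {y} → y ∈ filter Q? elements → Q y
    in-Q = proj₂ ∘ ∈-filter⁻ Q? {xs = elements}

  layerList : Subset → List P
  layerList S = filter (λ x → S x Bool.≟ true) elements

  toggleSet-as-toggles : ∀ {S} → NonAdjacent S → ∀ {I} → IsIdeal I →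
                         toggleSet S I ≗ toggles (layerList S) I
  toggleSet-as-toggles {S} nonAdj isIdeal x = sym (trans
    (toggles-filter (λ x → S x Bool.≟ true) (λ Sx Sy → nonAdj (≟true Sx) (≟true Sy)) isIdeal x)
    (toggleSet-congˡ (≟true-does ∘ S) _ x))
    where
    ≟true-does : ∀ b → does (b Bool.≟ true) ≡ b
    ≟true-does true = refl
    ≟true-does false = refl
    ≟true : ∀ {b} → does (b Bool.≟ true) ≡ true → b ≡ true
    ≟true {b} = trans (sym (≟true-does b))

  toggleSet-isIdeal : ∀ {S} → NonAdjacent S → ∀ {I} → IsIdeal I → IsIdeal (toggleSet S I)
  toggleSet-isIdeal {S} nonAdj isIdeal x y x≤y Ky =
    trans (toggleSet-as-toggles nonAdj isIdeal x)
      (toggles-isIdeal (layerList S) isIdeal x y x≤y (trans (sym (toggleSet-as-toggles nonAdj isIdeal y)) Ky))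

  toggledValue-toggleSet : ∀ {S v} → NonAdjacent S → S v ≡ false → (∀ {x} → S x ≡ true → ¬ Adjacent x v) →
                           ∀ {I} → IsIdeal I → toggledValue (toggleSet S I) v ≡ toggledValue I v
  toggledValue-toggleSet {S} {v} nonAdj Sv far isIdeal = trans
    (toggledValue-cong (toggleSet-as-toggles nonAdj isIdeal) v)
    (toggledValue-toggles isIdeal (layerList S) λ p∈ →
      let Sp = proj₂ (∈-filter⁻ (λ x → S x Bool.≟ true) {xs = elements} p∈) in
      (λ { refl → true≢false (trans (sym Sp) Sv) }) , far Sp)

  toggleSet-in : ∀ S I {x} → S x ≡ true → toggleSet S I x ≡ toggledValue I x
  toggleSet-in S I Sx rewrite Sx = refl

  toggleSet-out : ∀ S I {x} → S x ≡ false → toggleSet S I x ≡ I x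
  toggleSet-out S I Sx rewrite Sx = refl

  toggleSet-insert : ∀ {S T v} → NonAdjacent S → S v ≡ false → (∀ {x} → S x ≡ true → ¬ Adjacent x v) →
                     T v ≡ true → (∀ {x} → x ≢ v → T x ≡ S x) →
                     ∀ {I} → IsIdeal I → toggleSet T I ≗ toggle v (toggleSet S I)
  toggleSet-insert {S} {T} {v} nonAdj Sv far Tv T≡S {I} isIdeal x = at (x ≟ v)
    where
    at : Dec (x ≡ v) → toggleSet T I x ≡ toggle v (toggleSet S I) x
    at (yes refl) = begin
      toggleSet T I x                 ≡⟨ toggleSet-in T I Tv ⟩
      toggledValue I x                ≡⟨ toggledValue-toggleSet nonAdj Sv far isIdeal ⟨
      toggledValue (toggleSet S I) x  ≡⟨ toggle-self x (toggleSet S I) ⟨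
      toggle x (toggleSet S I) x      ∎
      where open ≡-Reasoning
    at (no x≢v) = trans (cong (λ b → if b then _ else _) (T≡S x≢v)) (sym (toggle-other v (toggleSet S I) x≢v))

  toggleSet-toggle : ∀ {S v} → NonAdjacent S → S v ≡ false → (∀ {x} → S x ≡ true → ¬ Adjacent x v) →
                     ∀ {I} → IsIdeal I → toggleSet S (toggle v I) ≗ toggle v (toggleSet S I)
  toggleSet-toggle {S} {v} nonAdj Sv far {I} isIdeal x = at (x ≟ v)
    where
    at : Dec (x ≡ v) → toggleSet S (toggle v I) x ≡ toggle v (toggleSet S I) x
    at (yes refl) = begin
      toggleSet S (toggle x I) x      ≡⟨ toggleSet-out S (toggle x I) Sv ⟩
      toggle x I x                    ≡⟨ toggle-self x I ⟩
      toggledValue I x                ≡⟨ toggledValue-toggleSet nonAdj Sv far isIdeal ⟨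
      toggledValue (toggleSet S I) x  ≡⟨ toggle-self x (toggleSet S I) ⟨
      toggle x (toggleSet S I) x      ∎
      where open ≡-Reasoning
    at (no x≢v) = trans (outside (S x) refl) (sym (toggle-other v (toggleSet S I) x≢v))
      where
      outside : ∀ b → S x ≡ b → toggleSet S (toggle v I) x ≡ toggleSet S I x
      outside true Sx = trans (toggleSet-in S _ Sx)
        (trans (toggledValue-toggle isIdeal x≢v (far Sx ∘ Data.Sum.swap)) (sym (toggleSet-in S I Sx)))
      outside false Sx = trans (toggleSet-out S _ Sx) (trans (toggle-other v I x≢v) (sym (toggleSet-out S I Sx)))

  CoverStep : (P → ℕ) → Set
  CoverStep f = ∀ {p q} → Cover p q → f q ≡ suc (f p) ⊎ f p ≡ suc (f q)

  coverStep-adjacent : ∀ {f} → CoverStep f → ∀ {p q} → Adjacent p q → f q ≡ suc (f p) ⊎ f p ≡ suc (f q)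
  coverStep-adjacent step (inj₁ p⋖q) = step p⋖q
  coverStep-adjacent step (inj₂ q⋖p) = Data.Sum.swap (step q⋖p)

  layer : (P → ℕ) → ℕ → Subset
  layer f t x = does (f x ℕ.≟ t)

  layer-nonAdjacent : ∀ {f} → CoverStep f → ∀ t → NonAdjacent (layer f t)
  layer-nonAdjacent {f} step t {x} {y} fx fy adj with does-true (f x ℕ.≟ t) fx | does-true (f y ℕ.≟ t) fy
  ... | fx≡t | fy≡t with coverStep-adjacent step adj
  ...   | inj₁ fy≡1+fx = ℕ.1+n≢n (trans (sym fy≡1+fx) (trans fy≡t (sym fx≡t)))
  ...   | inj₂ fx≡1+fy = ℕ.1+n≢n (trans (sym fx≡1+fy) (trans fx≡t (sym fy≡t)))

  sweep : (P → ℕ) → List ℕ → Subset → Subset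
  sweep f [] I = I
  sweep f (t ∷ ts) I = sweep f ts (toggleSet (layer f t) I)

  sweep-cong : ∀ f ts {I J} → I ≗ J → sweep f ts I ≗ sweep f ts J
  sweep-cong f [] I≗J = I≗J
  sweep-cong f (t ∷ ts) I≗J = sweep-cong f ts (toggleSet-cong (layer f t) I≗J)

  sweep-congᶠ : ∀ {f g} → f ≗ g → ∀ ts I → sweep f ts I ≗ sweep g ts I
  sweep-congᶠ f≗g [] I _ = refl
  sweep-congᶠ {f} {g} f≗g (t ∷ ts) I x = trans
    (sweep-cong f ts (toggleSet-congˡ (λ y → cong (λ m → does (m ℕ.≟ t)) (f≗g y)) I) x)
    (sweep-congᶠ f≗g ts _ x)

  sweep-isIdeal : ∀ {f} → CoverStep f → ∀ ts {I} → IsIdeal I → IsIdeal (sweep f ts I)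
  sweep-isIdeal step [] isIdeal = isIdeal
  sweep-isIdeal step (t ∷ ts) isIdeal = sweep-isIdeal step ts (toggleSet-isIdeal (layer-nonAdjacent step t) isIdeal)

  sweep-++ : ∀ f ts us I → sweep f (ts ++ us) I ≡ sweep f us (sweep f ts I)
  sweep-++ f [] us I = refl
  sweep-++ f (t ∷ ts) us I = sweep-++ f ts us _

  sweep-empty : ∀ f ts I → (∀ {t x} → t ∈ ts → f x ≢ t) → sweep f ts I ≗ I
  sweep-empty f [] I _ _ = refl
  sweep-empty f (t ∷ ts) I empty x = trans
    (sweep-cong f ts (λ y → toggleSet-out (layer f t) I (dec-false (f y ℕ.≟ t) (empty (here refl)))) x)
    (sweep-empty f ts I (empty ∘ there) x)

  toggles-layers : ∀ {f} → CoverStep f → ∀ ts {I} → IsIdeal I →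
                   toggles (concatMap (λ t → filter (λ x → f x ℕ.≟ t) elements) ts) I ≗ sweep f ts I
  toggles-layers step [] isIdeal _ = refl
  toggles-layers {f} step (t ∷ ts) {I} isIdeal x
    rewrite toggles-++ (filter (λ x → f x ℕ.≟ t) elements) (concatMap (λ t → filter (λ x → f x ℕ.≟ t) elements) ts) I =
    trans (toggles-cong (concatMap (λ t → filter (λ x → f x ℕ.≟ t) elements) ts)
            (toggles-filter (λ x → f x ℕ.≟ t) (layer-nonAdjacent step t) isIdeal) x)
          (toggles-layers step ts (toggleSet-isIdeal (layer-nonAdjacent step t) isIdeal) x)

  MinimalOutside : Subset → P → Set
  MinimalOutside I m = I m ≡ false × ¬ (∃ λ m' → m' < m × I m' ≡ false)

  minimalOutside? : ∀ I m → Dec (MinimalOutside I m)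
  minimalOutside? I m = (I m Bool.≟ false) ×-dec Dec.¬? (∃? λ m' → (m' <? m) ×-dec (I m' Bool.≟ false))

  row : Subset → Subset
  row I q = does (∃? λ m → minimalOutside? I m ×-dec (q ≤? m))

  row-intro : ∀ I {q} → (∃ λ m → MinimalOutside I m × q ≤ m) → row I q ≡ true
  row-intro I = dec-true (∃? _)

  row-elim : ∀ I {q} → row I q ≡ true → ∃ λ m → MinimalOutside I m × q ≤ m
  row-elim I = does-true (∃? _)

  row-isIdeal : ∀ I → IsIdeal (row I)
  row-isIdeal I p q p≤q Rq = let (m , min , q≤m) = row-elim I Rq in row-intro I (m , min , ≤-trans p≤q q≤m)

  hasAbove-row : ∀ I {x} → I x ≡ true → hasAbove (row I) x ≡ row I x
  hasAbove-row I {x} Ix = does-⇔ (∃? _) (∃? _)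
    (λ (y , x<y , Ry) → let (m , min , y≤m) = row-elim I Ry in m , min , ≤-trans (proj₁ x<y) y≤m)
    (λ (m , min@(Im , _) , x≤m) →
      m , (x≤m , λ { refl → true≢false (trans (sym Ix) Im) }) , row-intro I (m , min , ≤-refl))

  allBelow-row : ∀ I {x} → I x ≡ false → allBelow I x ≡ row I x
  allBelow-row I {x} Ix = does-⇔ (∀? _) (∃? _)
    (λ below → x , (Ix , λ (y , y<x , Iy) → true≢false (trans (sym (below y y<x)) Iy)) , ≤-refl)
    (λ (m , (_ , minimal) , x≤m) y y<x → ¬-not λ Iy → case x ≟ m of λ where
      (yes refl) → minimal (y , y<x , Iy)
      (no x≢m) → minimal (x , (x≤m , x≢m) , Ix))

  toggledValue-row : ∀ {S I x} → S x ≡ I x → (∀ {y} → x < y → S y ≡ row I y) → (∀ {y} → y < x → S y ≡ I y) →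
                     toggledValue S x ≡ row I x
  toggledValue-row {S} {I} {x} Sx above below with I x in Ix
  ... | true  = trans (toggledValue-in Sx) (trans (hasAbove-cong λ y x<y → above x<y) (hasAbove-row I Ix))
  ... | false = trans (toggledValue-out Sx) (trans (allBelow-cong λ y y<x → below y<x) (allBelow-row I Ix))

  module _ {g : P → ℕ} (g-anti : ∀ {x y} → x < y → g y ℕ.< g x) where

    sweep-row-prefix : ∀ T I x → sweep g (range 0 T) I x ≡ (if does (g x ℕ.<? T) then row I x else I x)
    sweep-row-prefix zero I x = refl
    sweep-row-prefix (suc T) I x = begin
      sweep g (range 0 (suc T)) I x         ≡⟨ cong (λ ts → sweep g ts I x) (range-∷ʳ 0 T) ⟩
      sweep g (range 0 T ++ T ∷ []) I x     ≡⟨ cong (λ J → J x) (sweep-++ g (range 0 T) (T ∷ []) I) ⟩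
      toggleSet (layer g T) S x             ≡⟨ last (g x ℕ.≟ T) ⟩
      (if does (g x ℕ.<? suc T) then row I x else I x) ∎
      where
      open ≡-Reasoning
      S : Subset
      S = sweep g (range 0 T) I
      last : Dec (g x ≡ T) → toggleSet (layer g T) S x ≡ (if does (g x ℕ.<? suc T) then row I x else I x)
      last (yes gx≡T) rewrite dec-true (g x ℕ.<? suc T) (ℕ.≤-reflexive (cong suc gx≡T)) =
        trans (toggleSet-in (layer g T) S (dec-true (g x ℕ.≟ T) gx≡T)) (toggledValue-row
          (trans (sweep-row-prefix T I x) (cong (if_then row I x else I x) (dec-false (g x ℕ.<? T) (ℕ.<-irrefl gx≡T))))
          (λ {y} x<y → trans (sweep-row-prefix T I y)
            (cong (if_then row I y else I y) (dec-true (g y ℕ.<? T) (ℕ.<-≤-trans (g-anti x<y) (ℕ.≤-reflexive gx≡T)))))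
          (λ {y} y<x → trans (sweep-row-prefix T I y)
            (cong (if_then row I y else I y) (dec-false (g y ℕ.<? T)
              λ gy<T → ℕ.<-asym (g-anti y<x) (ℕ.<-≤-trans gy<T (ℕ.≤-reflexive (sym gx≡T)))))))
      last (no gx≢T) = trans (toggleSet-out (layer g T) S (dec-false (g x ℕ.≟ T) gx≢T))
        (trans (sweep-row-prefix T I x) (cong (if_then row I x else I x) (does-⇔ (g x ℕ.<? T) (g x ℕ.<? suc T)
          ℕ.m<n⇒m<1+n (λ gx<1+T → ℕ.≤∧≢⇒< (ℕ.≤-pred gx<1+T) gx≢T))))

    sweep-row : ∀ {N} → (∀ x → g x ℕ.< N) → ∀ I → sweep g (range 0 N) I ≗ row I
    sweep-row {N} g<N I x rewrite sweep-row-prefix N I x | dec-true (g x ℕ.<? N) (g<N x) = refl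

  IsLocalMinimum : (P → ℕ) → P → Set
  IsLocalMinimum f v = ∀ {u} → Adjacent u v → f u ≡ suc (f v)

  raise : (P → ℕ) → P → P → ℕ
  raise f v x = if does (x ≟ v) then suc (suc (f v)) else f x

  raise-self : ∀ f v → raise f v v ≡ suc (suc (f v))
  raise-self f v rewrite dec-true (v ≟ v) refl = refl

  raise-other : ∀ f {v x} → x ≢ v → raise f v x ≡ f x
  raise-other f {v} {x} x≢v rewrite dec-false (x ≟ v) x≢v = refl

  raise-coverStep : ∀ {f v} → CoverStep f → IsLocalMinimum f v → CoverStep (raise f v)
  raise-coverStep {f} {v} step min {p} {q} p⋖q with p ≟ v | q ≟ v
  ... | yes refl | yes refl = ⊥-elim (<-irrefl (proj₁ p⋖q))
  ... | yes refl | no _     = inj₂ (cong suc (sym (min (inj₂ p⋖q))))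
  ... | no _     | yes refl = inj₁ (cong suc (sym (min (inj₁ p⋖q))))
  ... | no _     | no _     = step p⋖q

  lower : (P → ℕ) → P → P → ℕ
  lower e v x = if does (x ≟ v) then ℕ.pred (e v) else e x

  lower-≤ : ∀ e v x → lower e v x ℕ.≤ e x
  lower-≤ e v x with x ≟ v
  ... | yes refl = ℕ.pred[n]≤n
  ... | no _ = ℕ.≤-refl

  lower-self-< : ∀ {e : P → ℕ} {v} → 0 ℕ.< e v → lower e v v ℕ.< e v
  lower-self-< {e} {v} ev>0 rewrite dec-true (v ≟ v) refl = pred< ev>0

  raise-lower : ∀ {f g e : P → ℕ} {v} → (∀ x → g x ≡ f x + 2 * e x) → 0 ℕ.< e v →
                ∀ x → g x ≡ raise f v x + 2 * lower e v x
  raise-lower {f} {g} {e} {v} g≡ ev>0 x with x ≟ v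
  ... | no _ = g≡ x
  ... | yes refl = trans (g≡ x) (trans (cong (λ k → f x + 2 * k) (sym (ℕ.suc-pred (e x) {{ℕ.>-nonZero ev>0}})))
                                       (+-twice-suc (f x) _))

  module RaiseLocalMinimum {f} (step : CoverStep f) {v} (min : IsLocalMinimum f v) where

    private
      a : ℕ
      a = f v
      f′ : P → ℕ
      f′ = raise f v

    layer-far : ∀ {t} → t ≢ suc a → ∀ {x} → layer f t x ≡ true → ¬ Adjacent x v
    layer-far t≢1+a {x} fx adj = t≢1+a (trans (sym (does-true (f x ℕ.≟ _) fx)) (min adj))

    layer-raise-other : ∀ t {x} → x ≢ v → layer f′ t x ≡ layer f t x
    layer-raise-other t x≢v = cong (λ m → does (m ℕ.≟ t)) (raise-other f x≢v)

    layer-raise : ∀ {t} → t ≢ a → t ≢ suc (suc a) → layer f′ t ≗ layer f t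
    layer-raise {t} t≢a t≢2+a x = at (x ≟ v)
      where
      at : Dec (x ≡ v) → layer f′ t x ≡ layer f t x
      at (yes refl) = trans (cong (λ m → does (m ℕ.≟ t)) (raise-self f x))
        (trans (dec-false (_ ℕ.≟ t) (t≢2+a ∘ sym)) (sym (dec-false (_ ℕ.≟ t) (t≢a ∘ sym))))
      at (no x≢v) = layer-raise-other t x≢v

    sweep-raise-far : ∀ ts → (∀ {t} → t ∈ ts → t ℕ.< a ⊎ suc (suc a) ℕ.< t) →
                      ∀ {I} → IsIdeal I → sweep f′ ts (toggle v I) ≗ toggle v (sweep f ts I)
    sweep-raise-far [] _ _ _ = refl
    sweep-raise-far (t ∷ ts) far {I} isIdeal x = trans
      (sweep-cong f′ ts (λ y → trans (toggleSet-congˡ (layer-raise t≢a t≢2+a) _ y)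
        (toggleSet-toggle (layer-nonAdjacent step t) (dec-false (a ℕ.≟ t) (t≢a ∘ sym)) (layer-far t≢1+a) isIdeal y)) x)
      (sweep-raise-far ts (far ∘ there) (toggleSet-isIdeal (layer-nonAdjacent step t) isIdeal) x)
      where
      t≢a : t ≢ a
      t≢a = proj₁ (outside-window (far (here refl)))
      t≢1+a : t ≢ suc a
      t≢1+a = proj₁ (proj₂ (outside-window (far (here refl))))
      t≢2+a : t ≢ suc (suc a)
      t≢2+a = proj₂ (proj₂ (outside-window (far (here refl))))

    private
      step′ : CoverStep f′
      step′ = raise-coverStep step min

      a≢1+a : ∀ {m} → m ≢ suc m
      a≢1+a = ℕ.1+n≢n ∘ sym

      a≢2+a : ∀ {m} → m ≢ suc (suc m)
      a≢2+a = ℕ.<⇒≢ (ℕ.<-trans (ℕ.n<1+n _) (ℕ.n<1+n _))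

    sweep-raise-middle : ∀ {I} → IsIdeal I →
                         sweep f′ (a ∷ suc a ∷ suc (suc a) ∷ []) (toggle v I) ≗ toggle v (sweep f (a ∷ suc a ∷ suc (suc a) ∷ []) I)
    sweep-raise-middle {I} isIdeal x =
      trans (toggleSet-cong (layer f′ (suc (suc a))) bottom x)
            (top (toggleSet-isIdeal (layer-nonAdjacent step (suc a)) (toggleSet-isIdeal (layer-nonAdjacent step a) isIdeal)) x)
      where
      v∉L′₀ : layer f′ a v ≡ false
      v∉L′₀ = trans (cong (λ m → does (m ℕ.≟ a)) (raise-self f v)) (dec-false (_ ℕ.≟ a) (a≢2+a ∘ sym))
      L′₀-far : ∀ {y} → layer f′ a y ≡ true → ¬ Adjacent y v
      L′₀-far {y} L′₀y = case y ≟ v of λ where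
        (yes refl) → ⊥-elim (true≢false (trans (sym L′₀y) v∉L′₀))
        (no y≢v) → layer-far a≢1+a (trans (sym (layer-raise-other a y≢v)) L′₀y)
      lowest : toggleSet (layer f′ a) (toggle v I) ≗ toggleSet (layer f a) I
      lowest y = trans
        (toggleSet-toggle (layer-nonAdjacent step′ a) v∉L′₀ L′₀-far isIdeal y)
        (sym (toggleSet-insert (layer-nonAdjacent step′ a) v∉L′₀ L′₀-far (dec-true (a ℕ.≟ a) refl)
          (λ y≢v → sym (layer-raise-other a y≢v)) isIdeal y))
      bottom : toggleSet (layer f′ (suc a)) (toggleSet (layer f′ a) (toggle v I)) ≗
               toggleSet (layer f (suc a)) (toggleSet (layer f a) I)
      bottom y = trans (toggleSet-congˡ (layer-raise (a≢1+a ∘ sym) a≢1+a) _ y) (toggleSet-cong (layer f (suc a)) lowest y)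
      top : ∀ {Y} → IsIdeal Y → toggleSet (layer f′ (suc (suc a))) Y ≗ toggle v (toggleSet (layer f (suc (suc a))) Y)
      top = toggleSet-insert (layer-nonAdjacent step (suc (suc a))) (dec-false (a ℕ.≟ _) a≢2+a) (layer-far (a≢1+a ∘ sym))
        (trans (cong (λ m → does (m ℕ.≟ _)) (raise-self f v)) (dec-true (suc (suc a) ℕ.≟ suc (suc a)) refl))
        (layer-raise-other _)

    sweep-raise : ∀ {N} → suc (suc a) ℕ.< N → ∀ {I} → IsIdeal I →
                  sweep f′ (range 0 N) (toggle v I) ≗ toggle v (sweep f (range 0 N) I)
    sweep-raise {N} a+2<N {I} isIdeal =
      subst (λ N → sweep f′ (range 0 N) (toggle v I) ≗ toggle v (sweep f (range 0 N) I)) N≡ (split (N ∸ (a + 3)))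
      where
      N≡ : a + (3 + (N ∸ (a + 3))) ≡ N
      N≡ = trans (sym (ℕ.+-assoc a 3 _)) (ℕ.m+[n∸m]≡n (subst (ℕ._≤ N) (ℕ.+-comm 3 a) a+2<N))
      split : ∀ k → sweep f′ (range 0 (a + (3 + k))) (toggle v I) ≗ toggle v (sweep f (range 0 (a + (3 + k))) I)
      split k x rewrite range-++ 0 a (3 + k)
                      | sweep-++ f′ (range 0 a) (range a (3 + k)) (toggle v I)
                      | sweep-++ f (range 0 a) (range a (3 + k)) I = trans
        (sweep-cong f′ above (λ y → trans
          (sweep-cong f′ middle (sweep-raise-far (range 0 a) (inj₁ ∘ proj₂ ∘ ∈-range) isIdeal) y)
          (sweep-raise-middle (sweep-isIdeal step (range 0 a) isIdeal) y)) x)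
        (sweep-raise-far above (inj₂ ∘ proj₁ ∘ ∈-range) (sweep-isIdeal step middle (sweep-isIdeal step (range 0 a) isIdeal)) x)
        where
        middle above : List ℕ
        middle = a ∷ suc a ∷ suc (suc a) ∷ []
        above = range (3 + a) k

  lowest-positive-localMinimum : ∀ {f g e : P → ℕ} {v} → CoverStep f → CoverStep g → (∀ x → g x ≡ f x + 2 * e x) →
                                 0 ℕ.< e v → (∀ {x} → 0 ℕ.< e x → f v ℕ.≤ f x) → IsLocalMinimum f v
  lowest-positive-localMinimum {f} {g} {e} {v} stepf stepg g≡ ev>0 lowest {u} adj with coverStep-adjacent stepf adj
  ... | inj₂ fu≡1+fv = fu≡1+fv
  ... | inj₁ fv≡1+fu with e u in eu
  ...   | suc _ = ⊥-elim (ℕ.1+n≰n (subst (ℕ._≤ f u) fv≡1+fu (lowest (subst (0 ℕ.<_) (sym eu) (ℕ.s≤s ℕ.z≤n)))))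
  ...   | zero = ⊥-elim (gap-too-wide gap (Data.Sum.map (λ e → trans e (cong suc gu≡fu)) (λ e → trans (sym gu≡fu) e)
                                                    (coverStep-adjacent stepg adj)))
    where
    gu≡fu : g u ≡ f u
    gu≡fu = trans (g≡ u) (trans (cong (λ k → f u + 2 * k) eu) (ℕ.+-identityʳ (f u)))
    gap : suc (suc (suc (f u))) ℕ.≤ g v
    gap = subst (λ m → suc (suc m) ℕ.≤ g v) fv≡1+fu (positive-gap (g≡ v) ev>0)
    gap-too-wide : ∀ {m n} → suc (suc (suc m)) ℕ.≤ n → n ≡ suc m ⊎ m ≡ suc n → ⊥
    gap-too-wide (ℕ.s≤s 2+m≤m) (inj₁ refl) = ℕ.1+n≰n (ℕ.≤-trans (ℕ.n≤1+n _) 2+m≤m)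
    gap-too-wide 3+m≤n (inj₂ refl) = ℕ.1+n≰n (ℕ.≤-trans (ℕ.m≤n+m _ 3) 3+m≤n)

  module _ {N : ℕ} where

    Conjugate : (f g : P → ℕ) → Set
    Conjugate f g = ∃ λ w → ∀ {I} → IsIdeal I → sweep g (range 0 N) (toggles w I) ≗ toggles w (sweep f (range 0 N) I)

    sweep-conjugate : ∀ m {f g e : P → ℕ} → CoverStep f → CoverStep g → (∀ x → g x ≡ f x + 2 * e x) →
                      (∀ x → g x ℕ.< N) → sum (map e elements) ℕ.≤ m → Conjugate f g
    sweep-conjugate m {f} {g} {e} stepf stepg g≡ g<N Σe≤m with ∃? (λ x → 0 ℕ.<? e x)
    ... | no ¬positive = [] , λ {I} _ → sweep-congᶠ f≗g (range 0 N) I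
      where
      f≗g : g ≗ f
      f≗g x with e x in ex
      ... | zero = trans (g≡ x) (trans (cong (λ k → f x + 2 * k) ex) (ℕ.+-identityʳ (f x)))
      ... | suc _ = ⊥-elim (¬positive (x , subst (0 ℕ.<_) (sym ex) (ℕ.s≤s ℕ.z≤n)))
    ... | yes (u , eu>0) = descend m Σe≤m
      where
      positives : List P
      positives = filter (λ x → 0 ℕ.<? e x) elements
      v : P
      v = argmin f u positives
      ev>0 : 0 ℕ.< e v
      ev>0 = argmin-all f eu>0 (all-filter (λ x → 0 ℕ.<? e x) elements)
      lowest : ∀ {x} → 0 ℕ.< e x → f v ℕ.≤ f x
      lowest {x} ex>0 = All.lookup (f[argmin]≤f[xs] u positives) (∈-filter⁺ (λ x → 0 ℕ.<? e x) (∈-elements x) ex>0)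
      min : IsLocalMinimum f v
      min = lowest-positive-localMinimum stepf stepg g≡ ev>0 lowest
      Σlower≤ : ∀ {m} → sum (map e elements) ℕ.≤ suc m → sum (map (lower e v) elements) ℕ.≤ m
      Σlower≤ Σe≤1+m = ℕ.≤-pred (ℕ.<-≤-trans (sum-map-< elements (lower-≤ e v) (∈-elements v) (lower-self-< {e} ev>0)) Σe≤1+m)
      descend : ∀ m → sum (map e elements) ℕ.≤ m → Conjugate f g
      descend zero Σe≤0 = ⊥-elim (ℕ.<-irrefl refl (ℕ.<-≤-trans eu>0 (ℕ.≤-trans (≤-sum-map e (∈-elements u)) Σe≤0)))
      descend (suc m) Σe≤1+m
        with sweep-conjugate m (raise-coverStep stepf min) stepg (raise-lower {f} {g} {e} g≡ ev>0) g<N (Σlower≤ Σe≤1+m)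
      ... | w , conj = v ∷ w , λ {I} isIdeal x → trans
        (conj (toggle-isIdeal v isIdeal) x)
        (toggles-cong w (RaiseLocalMinimum.sweep-raise stepf min (ℕ.≤-<-trans (positive-gap (g≡ v) ev>0) (g<N v)) isIdeal) x)

    rowmotion-conjugate : ∀ {f g e : P → ℕ} → CoverStep f → CoverStep g → (∀ x → g x ≡ f x + 2 * e x) →
                          (∀ x → g x ℕ.< N) → (∀ {x y} → x < y → g y ℕ.< g x) →
                          ∃ λ w → ∀ {I} → IsIdeal I → toggles⁻¹ w (row I) ≗ sweep f (range 0 N) (toggles⁻¹ w I)
    rowmotion-conjugate {f} {g} {e} stepf stepg g≡ g<N g-anti with sweep-conjugate (sum (map e elements)) stepf stepg g≡ g<N ℕ.≤-refl
    ... | w , conj = w , λ {I} isIdeal x →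
      let J = toggles⁻¹ w I
          isIdealJ = toggles⁻¹-isIdeal w isIdeal
      in begin
      toggles⁻¹ w (row I) x                               ≡⟨ toggles⁻¹-cong w (sweep-row g-anti g<N I) x ⟨
      toggles⁻¹ w (sweep g (range 0 N) I) x               ≡⟨ toggles⁻¹-cong w (sweep-cong g (range 0 N) (toggles-inverseˡ w isIdeal)) x ⟨
      toggles⁻¹ w (sweep g (range 0 N) (toggles w J)) x   ≡⟨ toggles⁻¹-cong w (conj isIdealJ) x ⟩
      toggles⁻¹ w (toggles w (sweep f (range 0 N) J)) x   ≡⟨ toggles-inverseʳ w (sweep-isIdeal stepf (range 0 N) isIdealJ) x ⟩
      sweep f (range 0 N) J x                             ∎
      where open ≡-Reasoning

≤-+-nonneg : ∀ {x y} → 0ℤ ℤ.≤ y → x ℤ.≤ x ℤ.+ y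
≤-+-nonneg {x} 0≤y = subst (ℤ._≤ x ℤ.+ _) (ℤ.+-identityʳ x) (ℤ.+-mono-≤ (ℤ.≤-refl {x}) 0≤y)

dot : ∀ {m} → (Fin m → ℤ) → (Fin m → ℤ) → ℤ
dot {zero} _ _ = 0ℤ
dot {suc m} w v = w Fin.zero ℤ.* v Fin.zero ℤ.+ dot (w ∘ Fin.suc) (v ∘ Fin.suc)

dot-cong : ∀ {m} (w : Fin m → ℤ) {u v} → u ≗ v → dot w u ≡ dot w v
dot-cong {zero} w _ = refl
dot-cong {suc m} w u≗v = cong₂ ℤ._+_ (cong (w Fin.zero ℤ.*_) (u≗v Fin.zero)) (dot-cong (w ∘ Fin.suc) (u≗v ∘ Fin.suc))

dot-zero : ∀ {m} (w : Fin m → ℤ) {v} → (∀ k → v k ≡ 0ℤ) → dot w v ≡ 0ℤ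
dot-zero {zero} w _ = refl
dot-zero {suc m} w v≡0 rewrite v≡0 Fin.zero | ℤ.*-zeroʳ (w Fin.zero) =
  trans (ℤ.+-identityˡ _) (dot-zero (w ∘ Fin.suc) (v≡0 ∘ Fin.suc))

dot-+ : ∀ {m} (w u v : Fin m → ℤ) → dot w (λ k → u k ℤ.+ v k) ≡ dot w u ℤ.+ dot w v
dot-+ {zero} w u v = refl
dot-+ {suc m} w u v rewrite dot-+ (w ∘ Fin.suc) (u ∘ Fin.suc) (v ∘ Fin.suc) | ℤ.*-distribˡ-+ (w Fin.zero) (u Fin.zero) (v Fin.zero) =
  shuffle (w Fin.zero ℤ.* u Fin.zero) (w Fin.zero ℤ.* v Fin.zero) _ _
  where
  shuffle : ∀ a b c d → (a ℤ.+ b) ℤ.+ (c ℤ.+ d) ≡ (a ℤ.+ c) ℤ.+ (b ℤ.+ d)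
  shuffle = solve-∀

dot-neg : ∀ {m} (w v : Fin m → ℤ) → dot w (λ k → ℤ.- v k) ≡ ℤ.- dot w v
dot-neg {zero} w v = refl
dot-neg {suc m} w v rewrite dot-neg (w ∘ Fin.suc) (v ∘ Fin.suc) | sym (ℤ.neg-distribʳ-* (w Fin.zero) (v Fin.zero)) =
  sym (ℤ.neg-distrib-+ (w Fin.zero ℤ.* v Fin.zero) _)

dot-δ : ∀ {m} (w : Fin m → ℤ) a → dot w (δ a) ≡ w a
dot-δ {suc m} w Fin.zero rewrite ℤ.*-identityʳ (w Fin.zero) | dot-zero (w ∘ Fin.suc) (λ _ → refl) = ℤ.+-identityʳ _
dot-δ {suc m} w (Fin.suc a) rewrite ℤ.*-zeroʳ (w Fin.zero) =
  trans (ℤ.+-identityˡ _) (trans (dot-cong (w ∘ Fin.suc) δ-suc) (dot-δ (w ∘ Fin.suc) a))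
  where
  δ-suc : ∀ k → δ (Fin.suc a) (Fin.suc k) ≡ δ a k
  δ-suc k with a Fin.≟ k
  ... | yes _ = refl
  ... | no _ = refl

module PositiveRoots (n : ℕ) where

  lo hi : Root n → ℕ
  lo r = toℕ (i r)
  hi r = toℕ (j r)

  root-≡ : ∀ {r s : Root n} → lo r ≡ lo s → hi r ≡ hi s → plus r ≡ plus s → r ≡ s
  root-≡ {root a b p x} {root c d q y} e₁ e₂ e₃ with Fin.toℕ-injective e₁ | Fin.toℕ-injective e₂ | e₃
  ... | refl | refl | refl = cong (λ z → root a b z x) (Fin.<-irrelevant p q)

  _≟ᴿ_ : DecidableEquality (Root n)
  r ≟ᴿ s = Dec.map′ (λ (e₁ , e₂ , e₃) → root-≡ e₁ e₂ e₃) (λ { refl → refl , refl , refl })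
    ((lo r ℕ.≟ lo s) ×-dec (hi r ℕ.≟ hi s) ×-dec (plus r Bool.≟ plus s))

  IsLast : ℕ → Set
  IsLast b = suc b ≡ n

  -- The order in 0-based coordinates.  For e_a − e_b ≤ e_c + e_d with d = b the difference contains
  -- 2e_b = (e_b − e_{n−1}) + (e_b + e_{n−1}), which is unavailable when b is the last index.
  Below : Bool → Bool → ℕ → ℕ → ℕ → ℕ → Set
  Below false false a b c d = c ℕ.≤ a × b ℕ.≤ d
  Below false true  a b c d = c ℕ.≤ a × ¬ (d ≡ b × IsLast b)
  Below true  true  a b c d = c ℕ.≤ a × d ℕ.≤ b
  Below true  false _ _ _ _ = ⊥

  _⊑_ : Root n → Root n → Set
  r ⊑ s = Below (plus r) (plus s) (lo r) (hi r) (lo s) (hi s)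

  below? : ∀ x y a b c d → Dec (Below x y a b c d)
  below? false false a b c d = (c ℕ.≤? a) ×-dec (b ℕ.≤? d)
  below? false true  a b c d = (c ℕ.≤? a) ×-dec Dec.¬? ((d ℕ.≟ b) ×-dec (suc b ℕ.≟ n))
  below? true  true  a b c d = (c ℕ.≤? a) ×-dec (d ℕ.≤? b)
  below? true  false _ _ _ _ = no λ ()

  ⊑-refl : ∀ r → r ⊑ r
  ⊑-refl (root _ _ _ false) = ℕ.≤-refl , ℕ.≤-refl
  ⊑-refl (root _ _ _ true)  = ℕ.≤-refl , ℕ.≤-refl

  last-squeeze : ∀ {b d} → b ℕ.≤ d → d ℕ.< n → IsLast b → d ≡ b
  last-squeeze b≤d d<n refl = ℕ.≤-antisym (ℕ.≤-pred d<n) b≤d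

  ⊑-trans : ∀ r s t → r ⊑ s → s ⊑ t → r ⊑ t
  ⊑-trans (root _ _ _ false) (root _ _ _ false) (root _ _ _ false) (c≤a , b≤d) (e≤c , d≤f) = ℕ.≤-trans e≤c c≤a , ℕ.≤-trans b≤d d≤f
  ⊑-trans (root _ b _ false) (root _ d _ false) (root _ _ _ true) (c≤a , b≤d) (e≤c , ok) = ℕ.≤-trans e≤c c≤a ,
    λ (f≡b , last) → let d≡b = last-squeeze b≤d (Fin.toℕ<n d) last in
      ok (trans f≡b (sym d≡b) , subst IsLast (sym d≡b) last)
  ⊑-trans (root _ b _ false) (root _ d _ true) (root _ _ _ true) (c≤a , ok) (e≤c , f≤d) = ℕ.≤-trans e≤c c≤a ,
    λ (f≡b , last) → ok (last-squeeze (subst (ℕ._≤ _) f≡b f≤d) (Fin.toℕ<n d) last , last)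
  ⊑-trans (root _ _ _ true) (root _ _ _ true) (root _ _ _ true) (c≤a , d≤b) (e≤c , f≤d) = ℕ.≤-trans e≤c c≤a , ℕ.≤-trans f≤d d≤b
  ⊑-trans (root _ _ _ false) (root _ _ _ true) (root _ _ _ false) _ ()
  ⊑-trans (root _ _ _ true) (root _ _ _ false) _ () _
  ⊑-trans (root _ _ _ true) (root _ _ _ true) (root _ _ _ false) _ ()

  ⊑-antisym : ∀ r s → r ⊑ s → s ⊑ r → r ≡ s
  ⊑-antisym (root _ _ _ false) (root _ _ _ false) (c≤a , b≤d) (a≤c , d≤b) = root-≡ (ℕ.≤-antisym a≤c c≤a) (ℕ.≤-antisym b≤d d≤b) refl
  ⊑-antisym (root _ _ _ true) (root _ _ _ true) (c≤a , d≤b) (a≤c , b≤d) = root-≡ (ℕ.≤-antisym a≤c c≤a) (ℕ.≤-antisym b≤d d≤b) refl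
  ⊑-antisym (root _ _ _ false) (root _ _ _ true) _ ()
  ⊑-antisym (root _ _ _ true) (root _ _ _ false) () _

  Σvec : List (Root n) → Fin n → ℤ
  Σvec xs k = Data.List.foldr ℤ._+_ 0ℤ (map (λ r → vec r k) xs)

  Σvec-++ : ∀ xs ys k → Σvec (xs ++ ys) k ≡ Σvec xs k ℤ.+ Σvec ys k
  Σvec-++ [] ys k = sym (ℤ.+-identityˡ _)
  Σvec-++ (x ∷ xs) ys k rewrite Σvec-++ xs ys k = sym (ℤ.+-assoc (vec x k) _ _)

  δ-difference : ∀ a b → toℕ a ℕ.≤ toℕ b → ∃ λ xs → ∀ k → Σvec xs k ≡ δ a k ℤ.- δ b k
  δ-difference a b a≤b with ℕ.m≤n⇒m<n∨m≡n a≤b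
  ... | inj₁ a<b = root a b a<b false ∷ [] , λ k → ℤ.+-identityʳ _
  ... | inj₂ a≡b with Fin.toℕ-injective a≡b
  ...   | refl = [] , λ k → sym (ℤ.+-inverseʳ (δ a k))

  δ-twice : ∀ a → ¬ IsLast (toℕ a) → ∃ λ xs → ∀ k → Σvec xs k ≡ δ a k ℤ.+ δ a k
  δ-twice a notLast = root a last a<last false ∷ root a last a<last true ∷ [] , λ k → cancel (δ a k) (δ last k)
    where
    last : Fin n
    last = Fin.fromℕ< (pred< (ℕ.<-≤-trans (ℕ.s≤s ℕ.z≤n) (Fin.toℕ<n a)))
    a<last : toℕ a ℕ.< toℕ last
    a<last rewrite Fin.toℕ-fromℕ< (pred< (ℕ.<-≤-trans (ℕ.s≤s ℕ.z≤n) (Fin.toℕ<n a))) =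
      ℕ.pred-mono-≤ (ℕ.≤∧≢⇒< (Fin.toℕ<n a) notLast)
    cancel : ∀ u v → (u ℤ.+ ℤ.- v) ℤ.+ ((u ℤ.+ v) ℤ.+ 0ℤ) ≡ u ℤ.+ u
    cancel = solve-∀

  δ-sum : ∀ a b → ¬ (toℕ a ≡ toℕ b × IsLast (toℕ b)) → ∃ λ xs → ∀ k → Σvec xs k ≡ δ a k ℤ.+ δ b k
  δ-sum a b ok with ℕ.<-cmp (toℕ a) (toℕ b)
  ... | tri< a<b _ _ = root a b a<b true ∷ [] , λ k → ℤ.+-identityʳ _
  ... | tri> _ _ b<a = root b a b<a true ∷ [] , λ k → trans (ℤ.+-identityʳ _) (ℤ.+-comm (δ b k) (δ a k))
  ... | tri≈ _ a≡b _ with Fin.toℕ-injective a≡b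
  ...   | refl = δ-twice a λ last → ok (refl , last)

  by-sums : ∀ {r s} {u v : Fin n → ℤ} xs ys → Σvec xs ≗ u → Σvec ys ≗ v →
            (∀ k → vec s k ≡ vec r k ℤ.+ (u k ℤ.+ v k)) → r ≤R s
  by-sums {r} xs ys Σxs Σys h = xs ++ ys , λ k →
    trans (h k) (cong (λ z → vec r k ℤ.+ z) (sym (trans (Σvec-++ xs ys k) (cong₂ ℤ._+_ (Σxs k) (Σys k)))))

  ⊑⇒≤R : ∀ r s → r ⊑ s → r ≤R s
  ⊑⇒≤R r@(root a b _ false) s@(root c d _ false) (c≤a , b≤d) with δ-difference c a c≤a | δ-difference b d b≤d
  ... | xs , Σxs | ys , Σys = by-sums {r} {s} xs ys Σxs Σys λ k → identity (δ a k) (δ b k) (δ c k) (δ d k)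
    where
    identity : ∀ a b c d → c ℤ.+ ℤ.- d ≡ (a ℤ.+ ℤ.- b) ℤ.+ ((c ℤ.- a) ℤ.+ (b ℤ.- d))
    identity = solve-∀
  ⊑⇒≤R r@(root a b _ false) s@(root c d _ true) (c≤a , ok) with δ-difference c a c≤a | δ-sum d b ok
  ... | xs , Σxs | ys , Σys = by-sums {r} {s} xs ys Σxs Σys λ k → identity (δ a k) (δ b k) (δ c k) (δ d k)
    where
    identity : ∀ a b c d → c ℤ.+ d ≡ (a ℤ.+ ℤ.- b) ℤ.+ ((c ℤ.- a) ℤ.+ (d ℤ.+ b))
    identity = solve-∀
  ⊑⇒≤R r@(root a b _ true) s@(root c d _ true) (c≤a , d≤b) with δ-difference c a c≤a | δ-difference d b d≤b
  ... | xs , Σxs | ys , Σys = by-sums {r} {s} xs ys Σxs Σys λ k → identity (δ a k) (δ b k) (δ c k) (δ d k)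
    where
    identity : ∀ a b c d → c ℤ.+ d ≡ (a ℤ.+ b) ℤ.+ ((c ℤ.- a) ℤ.+ (d ℤ.- b))
    identity = solve-∀
  ⊑⇒≤R (root _ _ _ true) (root _ _ _ false) ()

  ⟪_∣_⟫ : (Fin n → ℤ) → Root n → ℤ
  ⟪ w ∣ r ⟫ = w (i r) ℤ.+ (if plus r then w (j r) else ℤ.- w (j r))

  dot-vec : ∀ w r → dot w (vec r) ≡ ⟪ w ∣ r ⟫
  dot-vec w (root a b _ true) = trans (dot-+ w (δ a) (δ b)) (cong₂ ℤ._+_ (dot-δ w a) (dot-δ w b))
  dot-vec w (root a b _ false) =
    trans (dot-+ w (δ a) (λ k → ℤ.- δ b k)) (cong₂ ℤ._+_ (dot-δ w a) (trans (dot-neg w (δ b)) (cong ℤ.-_ (dot-δ w b))))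

  Positive : (Fin n → ℤ) → Set
  Positive w = ∀ r → 0ℤ ℤ.≤ ⟪ w ∣ r ⟫

  dot-Σvec-nonneg : ∀ {w} → Positive w → ∀ xs → 0ℤ ℤ.≤ dot w (Σvec xs)
  dot-Σvec-nonneg {w} _ [] = ℤ.≤-reflexive (sym (dot-zero w λ _ → refl))
  dot-Σvec-nonneg {w} pos (x ∷ xs) = subst (0ℤ ℤ.≤_) (sym (dot-+ w (vec x) (Σvec xs)))
    (ℤ.+-mono-≤ (subst (0ℤ ℤ.≤_) (sym (dot-vec w x)) (pos x)) (dot-Σvec-nonneg pos xs))

  pairing-mono : ∀ {w} → Positive w → ∀ {r s} → r ≤R s → ⟪ w ∣ r ⟫ ℤ.≤ ⟪ w ∣ s ⟫
  pairing-mono {w} pos {r} {s} (xs , vs≡) = begin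
    ⟪ w ∣ r ⟫                                   ≡⟨ dot-vec w r ⟨
    dot w (vec r)                               ≤⟨ ≤-+-nonneg (dot-Σvec-nonneg pos xs) ⟩
    dot w (vec r) ℤ.+ dot w (Σvec xs)           ≡⟨ dot-+ w (vec r) (Σvec xs) ⟨
    dot w (λ k → vec r k ℤ.+ Σvec xs k)         ≡⟨ dot-cong w vs≡ ⟨
    dot w (vec s)                               ≡⟨ dot-vec w s ⟩
    ⟪ w ∣ s ⟫                                   ∎
    where open ℤ.≤-Reasoning

  refute : ∀ w → Positive w → ∀ r s → r ≤R s → ∀ {x y} → ⟪ w ∣ r ⟫ ≡ x → ⟪ w ∣ s ⟫ ≡ y → True (y ℤ.<? x) → ⊥
  refute w pos r s r≤s {x} {y} wr≡ ws≡ y<x =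
    ℤ.<⇒≱ (subst₂ ℤ._<_ (sym ws≡) (sym wr≡) (toWitness {a? = y ℤ.<? x} y<x)) (pairing-mono {w} pos {r} {s} r≤s)

  -- Two families of weights nonnegative on positive roots; via refute they recover the coordinate order.
  indicator : ∀ {A : Set} → Dec A → ℤ
  indicator (yes _) = 1ℤ
  indicator (no _) = 0ℤ

  prefix : ℕ → Fin n → ℤ
  prefix m k = indicator (toℕ k ℕ.<? m)

  prefix-in : ∀ {m} k → toℕ k ℕ.< m → prefix m k ≡ 1ℤ
  prefix-in {m} k k<m with toℕ k ℕ.<? m
  ... | yes _ = refl
  ... | no k≮m = ⊥-elim (k≮m k<m)

  prefix-out : ∀ {m} k → ¬ toℕ k ℕ.< m → prefix m k ≡ 0ℤ
  prefix-out {m} k k≮m with toℕ k ℕ.<? m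
  ... | yes k<m = ⊥-elim (k≮m k<m)
  ... | no _ = refl

  prefix-positive : ∀ m → Positive (prefix m)
  prefix-positive m (root a b a<b s) with toℕ a ℕ.<? m | toℕ b ℕ.<? m | s
  ... | yes _ | yes _ | true  = ℤ.+≤+ ℕ.z≤n
  ... | yes _ | yes _ | false = ℤ.+≤+ ℕ.z≤n
  ... | yes _ | no _  | true  = ℤ.+≤+ ℕ.z≤n
  ... | yes _ | no _  | false = ℤ.+≤+ ℕ.z≤n
  ... | no _  | yes _ | true  = ℤ.+≤+ ℕ.z≤n
  ... | no a≮m | yes b<m | false = ⊥-elim (a≮m (ℕ.<-trans a<b b<m))
  ... | no _  | no _  | true  = ℤ.+≤+ ℕ.z≤n
  ... | no _  | no _  | false = ℤ.+≤+ ℕ.z≤n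

  lo-not-last : ∀ r → ¬ IsLast (lo r)
  lo-not-last r last = ℕ.<⇒≱ (Fin.toℕ<n (j r)) (subst (ℕ._≤ hi r) last (i<j r))

  negateIf : ∀ {A : Set} → Dec A → ℤ
  negateIf (yes _) = -1ℤ
  negateIf (no _) = 1ℤ

  lastNegated : Fin n → ℤ
  lastNegated k = negateIf (suc (toℕ k) ℕ.≟ n)

  lastNegated-last : ∀ k → IsLast (toℕ k) → lastNegated k ≡ -1ℤ
  lastNegated-last k last with suc (toℕ k) ℕ.≟ n
  ... | yes _ = refl
  ... | no notLast = ⊥-elim (notLast last)

  lastNegated-notLast : ∀ k → ¬ IsLast (toℕ k) → lastNegated k ≡ 1ℤ
  lastNegated-notLast k notLast with suc (toℕ k) ℕ.≟ n
  ... | yes last = ⊥-elim (notLast last)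
  ... | no _ = refl

  lastNegated-positive : Positive lastNegated
  lastNegated-positive r@(root a b _ s) rewrite lastNegated-notLast a (lo-not-last r) with suc (toℕ b) ℕ.≟ n | s
  ... | yes _ | true  = ℤ.+≤+ ℕ.z≤n
  ... | yes _ | false = ℤ.+≤+ ℕ.z≤n
  ... | no _  | true  = ℤ.+≤+ ℕ.z≤n
  ... | no _  | false = ℤ.+≤+ ℕ.z≤n

  pairing-≡ : ∀ {w} r {x y} → w (i r) ≡ x → w (j r) ≡ y → ⟪ w ∣ r ⟫ ≡ x ℤ.+ (if plus r then y else ℤ.- y)
  pairing-≡ r refl refl = refl

  pairing-hi-zero : ∀ {w} r → w (j r) ≡ 0ℤ → ⟪ w ∣ r ⟫ ≡ w (i r)
  pairing-hi-zero {w} (root a b _ true) wb≡0 = trans (cong (λ y → w a ℤ.+ y) wb≡0) (ℤ.+-identityʳ _)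
  pairing-hi-zero {w} (root a b _ false) wb≡0 = trans (cong (λ y → w a ℤ.+ ℤ.- y) wb≡0) (ℤ.+-identityʳ _)

  lo-antitone : ∀ r s → r ≤R s → lo s ℕ.≤ lo r
  lo-antitone r s r≤s with lo s ℕ.≤? lo r
  ... | yes ok = ok
  ... | no lo-s≰lo-r = ⊥-elim (refute (prefix (suc (lo r))) (prefix-positive (suc (lo r))) r s r≤s ⟪r⟫≡1 ⟪s⟫≡0 _)
    where
    ⟪r⟫≡1 : ⟪ prefix (suc (lo r)) ∣ r ⟫ ≡ 1ℤ
    ⟪r⟫≡1 = trans (pairing-hi-zero {prefix (suc (lo r))} r (prefix-out (j r) λ hr<1+lr → ℕ.<⇒≱ (i<j r) (ℕ.≤-pred hr<1+lr)))
                  (prefix-in (i r) ℕ.≤-refl)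
    ⟪s⟫≡0 : ⟪ prefix (suc (lo r)) ∣ s ⟫ ≡ 0ℤ
    ⟪s⟫≡0 = trans (pairing-hi-zero {prefix (suc (lo r))} s (prefix-out (j s)
                    λ hs<1+lr → lo-s≰lo-r (ℕ.<⇒≤ (ℕ.<-≤-trans (i<j s) (ℕ.≤-pred hs<1+lr)))))
                  (prefix-out (i s) (lo-s≰lo-r ∘ ℕ.≤-pred))

  ≤R⇒⊑ : ∀ r s → r ≤R s → r ⊑ s
  ≤R⇒⊑ r@(root a b a<b false) s@(root c d c<d false) r≤s = lo-antitone r s r≤s , hi-monotone
    where
    hi-monotone : toℕ b ℕ.≤ toℕ d
    hi-monotone with toℕ b ℕ.≤? toℕ d
    ... | yes b≤d = b≤d
    ... | no b≰d = ⊥-elim (refute (prefix (toℕ b)) (prefix-positive (toℕ b)) r s r≤s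
      (pairing-≡ r (prefix-in a a<b) (prefix-out b (ℕ.<-irrefl refl)))
      (pairing-≡ s (prefix-in c (ℕ.<-trans c<d d<b)) (prefix-in d d<b)) _)
      where d<b = ℕ.≰⇒> b≰d
  ≤R⇒⊑ r@(root a b a<b false) s@(root c d c<d true) r≤s = lo-antitone r s r≤s , λ (d≡b , last) →
    refute lastNegated lastNegated-positive r s r≤s
      (pairing-≡ r (lastNegated-notLast a (lo-not-last r)) (lastNegated-last b last))
      (pairing-≡ s (lastNegated-notLast c (lo-not-last s)) (lastNegated-last d (subst IsLast (sym d≡b) last))) _
  ≤R⇒⊑ r@(root a b a<b true) s@(root c d c<d true) r≤s = c≤a , hi-antitone
    where
    c≤a : toℕ c ℕ.≤ toℕ a
    c≤a = lo-antitone r s r≤s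
    hi-antitone : toℕ d ℕ.≤ toℕ b
    hi-antitone with toℕ d ℕ.≤? toℕ b
    ... | yes d≤b = d≤b
    ... | no d≰b = ⊥-elim (refute (prefix (suc (toℕ b))) (prefix-positive (suc (toℕ b))) r s r≤s
      (pairing-≡ r (prefix-in a (ℕ.<-trans a<b (ℕ.n<1+n _))) (prefix-in b (ℕ.n<1+n _)))
      (pairing-≡ s (prefix-in c (ℕ.s≤s (ℕ.≤-trans c≤a (ℕ.<⇒≤ a<b)))) (prefix-out d (ℕ.<⇒≱ (ℕ.≰⇒> d≰b) ∘ ℕ.≤-pred))) _)
  ≤R⇒⊑ r@(root a b _ true) s@(root c d _ false) r≤s = refute (prefix n) (prefix-positive n) r s r≤s
    (pairing-≡ r (prefix-in a (Fin.toℕ<n a)) (prefix-in b (Fin.toℕ<n b)))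
    (pairing-≡ s (prefix-in c (Fin.toℕ<n c)) (prefix-in d (Fin.toℕ<n d))) _

  ≤R-isDecPartialOrder : IsDecPartialOrder _≡_ (_≤R_ {n})
  ≤R-isDecPartialOrder = record
    { isPartialOrder = record
      { isPreorder = record
        { isEquivalence = Eq.isEquivalence
        ; reflexive = λ { {r} refl → ⊑⇒≤R r r (⊑-refl r) }
        ; trans = λ {r} {s} {t} r≤s s≤t → ⊑⇒≤R r t (⊑-trans r s t (≤R⇒⊑ r s r≤s) (≤R⇒⊑ s t s≤t))
        }
      ; antisym = λ {r} {s} r≤s s≤r → ⊑-antisym r s (≤R⇒⊑ r s r≤s) (≤R⇒⊑ s r s≤r)
      }
    ; _≟_ = _≟ᴿ_
    ; _≤?_ = λ r s → Dec.map′ (⊑⇒≤R r s) (≤R⇒⊑ r s) (below? (plus r) (plus s) (lo r) (hi r) (lo s) (hi s))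
    }

  ∈-pairRoots : ∀ (r : Root n) → r ∈ pairRoots (i r) (j r)
  ∈-pairRoots (root a b a<b s) with a Fin.<? b
  ... | no a≮b = ⊥-elim (a≮b a<b)
  ... | yes a<b′ with Fin.<-irrelevant a<b a<b′ | s
  ...   | refl | false = here refl
  ...   | refl | true = there (here refl)

  pairRoots-coordinates : ∀ (a b : Fin n) {r} → r ∈ pairRoots a b → i r ≡ a × j r ≡ b
  pairRoots-coordinates a b r∈ with a Fin.<? b
  pairRoots-coordinates a b (here refl) | yes _ = refl , refl
  pairRoots-coordinates a b (there (here refl)) | yes _ = refl , refl

  pairRoots-unique : ∀ (a b : Fin n) → Unique (pairRoots a b)
  pairRoots-unique a b with a Fin.<? b
  ... | yes _ = ((λ ()) All.∷ All.[]) AllPairs.∷ (All.[] AllPairs.∷ AllPairs.[])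
  ... | no _ = AllPairs.[]

  ∈-allRoots : ∀ (r : Root n) → r ∈ allRoots n
  ∈-allRoots r = ∈-concatMap⁺ _ (∈-allFin (i r)) (∈-concatMap⁺ (pairRoots (i r)) (∈-allFin (j r)) (∈-pairRoots r))

  allRoots-unique : Unique (allRoots n)
  allRoots-unique = concatMap-unique _ (Unique.allFin⁺ n)
    (λ a → concatMap-unique (pairRoots a) (Unique.allFin⁺ n) (pairRoots-unique a)
      (λ {b} {b′} r∈ r∈′ → trans (sym (proj₂ (pairRoots-coordinates a b r∈))) (proj₂ (pairRoots-coordinates a b′ r∈′))))
    (λ {a} {a′} r∈ r∈′ → trans (sym (lo-of a r∈)) (lo-of a′ r∈′))
    where
    lo-of : ∀ (a : Fin n) {r} → r ∈ concatMap (pairRoots a) (Data.List.allFin n) → i r ≡ a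
    lo-of a r∈ with ∈-concatMap⁻ (pairRoots a) (Data.List.allFin n) r∈
    ... | b , _ , r∈′ = proj₁ (pairRoots-coordinates a b r∈′)

  colᶜ : Bool → ℕ → ℕ → ℕ
  colᶜ false a b = suc a + suc b
  colᶜ true a b = 2 * n ∸ (b ∸ a)

  col-coordinates : ∀ r → col r ≡ colᶜ (plus r) (lo r) (hi r)
  col-coordinates (root _ _ _ false) = refl
  col-coordinates (root _ _ _ true) = refl

  excessᶜ : Bool → ℕ → ℕ → ℕ
  excessᶜ false a b = 2 * n ∸ suc b
  excessᶜ true a b = suc b

  -- 4n minus the height of the root.
  depthᶜ : Bool → ℕ → ℕ → ℕ
  depthᶜ x a b = colᶜ x a b + 2 * excessᶜ x a b

  suc≤2n : ∀ {b} → b ℕ.< n → suc b ℕ.≤ 2 * n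
  suc≤2n b<n = ℕ.≤-trans b<n (ℕ.m≤m+n n _)

  colᶜ-plus : ∀ {a b} → a ℕ.≤ b → b ℕ.< n → colᶜ true a b + b ≡ 2 * n + a
  colᶜ-plus {a} {b} a≤b b<n = begin
    (2 * n ∸ (b ∸ a)) + b              ≡⟨ cong ((2 * n ∸ (b ∸ a)) +_) (ℕ.m+[n∸m]≡n a≤b) ⟨
    (2 * n ∸ (b ∸ a)) + (a + (b ∸ a))  ≡⟨ shuffle (2 * n ∸ (b ∸ a)) a (b ∸ a) ⟩
    ((2 * n ∸ (b ∸ a)) + (b ∸ a)) + a  ≡⟨ cong (_+ a) (ℕ.m∸n+n≡m (ℕ.≤-trans (ℕ.m∸n≤m b a) (ℕ.<⇒≤ (suc≤2n b<n)))) ⟩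
    2 * n + a                          ∎
    where
    open ≡-Reasoning
    shuffle : ∀ x a k → x + (a + k) ≡ (x + k) + a
    shuffle = ℕ-solve-∀

  depthᶜ-minus : ∀ {a b} → b ℕ.< n → depthᶜ false a b + b ≡ 4 * n + a
  depthᶜ-minus {a} {b} b<n = begin
    (suc a + suc b) + 2 * E + b        ≡⟨ shuffle a b E ⟩
    2 * (E + suc b) + a                ≡⟨ cong (λ m → 2 * m + a) (ℕ.m∸n+n≡m (suc≤2n b<n)) ⟩
    2 * (2 * n) + a                    ≡⟨ cong (_+ a) (ℕ.*-assoc 2 2 n) ⟨
    4 * n + a                          ∎
    where
    open ≡-Reasoning
    E : ℕ
    E = 2 * n ∸ suc b
    shuffle : ∀ a b E → (suc a + suc b) + 2 * E + b ≡ 2 * (E + suc b) + a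
    shuffle = ℕ-solve-∀

  depthᶜ-plus : ∀ {a b} → a ℕ.≤ b → b ℕ.< n → depthᶜ true a b ≡ 2 * n + (a + b) + 2
  depthᶜ-plus {a} {b} a≤b b<n = ℕ.+-cancelʳ-≡ b _ _ (begin
    colᶜ true a b + 2 * suc b + b      ≡⟨ shuffle (colᶜ true a b) b ⟩
    (colᶜ true a b + b) + 2 * suc b    ≡⟨ cong (_+ 2 * suc b) (colᶜ-plus a≤b b<n) ⟩
    2 * n + a + 2 * suc b              ≡⟨ shuffle′ (2 * n) a b ⟩
    2 * n + (a + b) + 2 + b            ∎)
    where
    open ≡-Reasoning
    shuffle : ∀ c b → c + 2 * suc b + b ≡ (c + b) + 2 * suc b
    shuffle = ℕ-solve-∀
    shuffle′ : ∀ m a b → m + a + 2 * suc b ≡ m + (a + b) + 2 + b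
    shuffle′ = ℕ-solve-∀

  -- Adding a simple root e_k − e_{k+1} or e_{n−2} + e_{n−1}; by refine these are the covers.
  data Move : Bool → ℕ → ℕ → Bool → ℕ → ℕ → Set where
    lower-lo⁻        : ∀ {a b} → Move false (suc a) b false a b
    raise-hi⁻        : ∀ {a b} → Move false a b false a (suc b)
    lower-lo⁺        : ∀ {a b} → Move true (suc a) b true a b
    lower-hi⁺        : ∀ {a b} → Move true a (suc b) true a b
    turn-last        : ∀ {a b} → IsLast (suc b) → Move false a (suc b) true a b
    turn-second-last : ∀ {a b} → IsLast (suc b) → Move false a b true a (suc b)

  move-below : ∀ {x a b y c d} → Move x a b y c d → Below x y a b c d
  move-below lower-lo⁻ = ℕ.n≤1+n _ , ℕ.≤-refl
  move-below raise-hi⁻ = ℕ.≤-refl , ℕ.n≤1+n _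
  move-below lower-lo⁺ = ℕ.n≤1+n _ , ℕ.≤-refl
  move-below lower-hi⁺ = ℕ.≤-refl , ℕ.n≤1+n _
  move-below (turn-last _) = ℕ.≤-refl , λ (b≡1+b , _) → ℕ.1+n≢n (sym b≡1+b)
  move-below (turn-second-last _) = ℕ.≤-refl , λ (1+b≡b , _) → ℕ.1+n≢n 1+b≡b

  move-depth : ∀ {x a b y c d} → Move x a b y c d → a ℕ.< b → b ℕ.< n → c ℕ.< d → d ℕ.< n →
               depthᶜ x a b ≡ suc (depthᶜ y c d)
  move-depth {a = suc a} {b} lower-lo⁻ _ b<n _ _ = ℕ.+-cancelʳ-≡ b _ _
    (trans (depthᶜ-minus b<n) (trans (ℕ.+-suc (4 * n) a) (cong suc (sym (depthᶜ-minus b<n)))))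
  move-depth {a = a} {b} raise-hi⁻ _ b<n _ 1+b<n = ℕ.+-cancelʳ-≡ b _ _
    (trans (depthᶜ-minus {a} b<n) (trans (sym (depthᶜ-minus {a} 1+b<n)) (ℕ.+-suc _ b)))
  move-depth {a = suc a} {b} lower-lo⁺ 1+a<b b<n a<b _ =
    trans (depthᶜ-plus (ℕ.<⇒≤ 1+a<b) b<n) (trans (shift (2 * n) a b) (cong suc (sym (depthᶜ-plus (ℕ.<⇒≤ a<b) b<n))))
    where
    shift : ∀ m a b → m + (suc a + b) + 2 ≡ suc (m + (a + b) + 2)
    shift = ℕ-solve-∀
  move-depth {a = a} {suc b} lower-hi⁺ a<1+b 1+b<n a<b b<n =
    trans (depthᶜ-plus (ℕ.<⇒≤ a<1+b) 1+b<n) (trans (shift (2 * n) a b) (cong suc (sym (depthᶜ-plus (ℕ.<⇒≤ a<b) b<n))))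
    where
    shift : ∀ m a b → m + (a + suc b) + 2 ≡ suc (m + (a + b) + 2)
    shift = ℕ-solve-∀
  move-depth {a = a} {suc b} (turn-last last) _ 1+b<n a<b b<n = ℕ.+-cancelʳ-≡ (suc b) _ _
    (trans (depthᶜ-minus 1+b<n) (trans (subst (λ m → 4 * m + a ≡ suc (2 * m + (a + b) + 2) + suc b) last (arith a b))
      (cong (λ m → suc m + suc b) (sym (depthᶜ-plus (ℕ.<⇒≤ a<b) b<n)))))
    where
    arith : ∀ a b → 4 * suc (suc b) + a ≡ suc (2 * suc (suc b) + (a + b) + 2) + suc b
    arith = ℕ-solve-∀
  move-depth {a = a} {b} (turn-second-last last) _ b<n a<1+b 1+b<n = ℕ.+-cancelʳ-≡ b _ _
    (trans (depthᶜ-minus b<n) (trans (subst (λ m → 4 * m + a ≡ suc (2 * m + (a + suc b) + 2) + b) last (arith a b))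
      (cong (λ m → suc m + b) (sym (depthᶜ-plus (ℕ.<⇒≤ a<1+b) 1+b<n)))))
    where
    arith : ∀ a b → 4 * suc (suc b) + a ≡ suc (2 * suc (suc b) + (a + suc b) + 2) + b
    arith = ℕ-solve-∀

  move-col : ∀ {x a b y c d} → Move x a b y c d → a ℕ.< b → b ℕ.< n → c ℕ.< d → d ℕ.< n →
             colᶜ y c d ≡ suc (colᶜ x a b) ⊎ colᶜ x a b ≡ suc (colᶜ y c d)
  move-col lower-lo⁻ _ _ _ _ = inj₂ refl
  move-col {a = a} {b} raise-hi⁻ _ _ _ _ = inj₁ (ℕ.+-suc (suc a) (suc b))
  move-col {a = suc a} {b} lower-lo⁺ 1+a<b b<n a<b _ = inj₂ (ℕ.+-cancelʳ-≡ b _ _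
    (trans (colᶜ-plus (ℕ.<⇒≤ 1+a<b) b<n) (trans (ℕ.+-suc (2 * n) a) (cong suc (sym (colᶜ-plus (ℕ.<⇒≤ a<b) b<n))))))
  move-col {a = a} {suc b} lower-hi⁺ a<1+b 1+b<n a<b b<n = inj₁ (ℕ.+-cancelʳ-≡ b _ _
    (trans (colᶜ-plus (ℕ.<⇒≤ a<b) b<n) (trans (sym (colᶜ-plus (ℕ.<⇒≤ a<1+b) 1+b<n)) (ℕ.+-suc _ b))))
  move-col {a = a} {suc b} (turn-last last) _ _ a<b b<n = inj₁ (ℕ.+-cancelʳ-≡ b _ _
    (trans (colᶜ-plus (ℕ.<⇒≤ a<b) b<n) (subst (λ m → 2 * m + a ≡ suc (suc a + suc (suc b)) + b) last (arith a b))))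
    where
    arith : ∀ a b → 2 * suc (suc b) + a ≡ suc (suc a + suc (suc b)) + b
    arith = ℕ-solve-∀
  move-col {a = a} {b} (turn-second-last last) _ _ a<1+b 1+b<n = inj₁ (ℕ.+-cancelʳ-≡ (suc b) _ _
    (trans (colᶜ-plus (ℕ.<⇒≤ a<1+b) 1+b<n) (subst (λ m → 2 * m + a ≡ suc (suc a + suc b) + suc b) last (arith a b))))
    where
    arith : ∀ a b → 2 * suc (suc b) + a ≡ suc (suc a + suc b) + suc b
    arith = ℕ-solve-∀

  record Refinement (x y : Bool) (a b c d : ℕ) : Set where
    constructor refinement
    field
      {z}   : Bool
      {a′}  : ℕ
      {b′}  : ℕ
      move  : Move x a b z a′ b′
      a′<b′ : a′ ℕ.< b′
      b′<n  : b′ ℕ.< n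
      below : Below z y a′ b′ c d

  refine : ∀ {x y a b c d} → a ℕ.< b → b ℕ.< n → c ℕ.< d → d ℕ.< n →
           Below x y a b c d → ¬ (x ≡ y × a ≡ c × b ≡ d) → Refinement x y a b c d
  refine {false} {false} {b = b} {d = d} a<b b<n c<d d<n (c≤a , b≤d) distinct with ℕ.m≤n⇒m<n∨m≡n c≤a
  ... | inj₁ (ℕ.s≤s c≤a₀) = refinement lower-lo⁻ (ℕ.<-trans (ℕ.n<1+n _) a<b) b<n (c≤a₀ , b≤d)
  ... | inj₂ refl = refinement raise-hi⁻ (ℕ.<-trans a<b (ℕ.n<1+n _)) (ℕ.≤-<-trans b<d d<n) (c≤a , b<d)
    where
    b<d : b ℕ.< d
    b<d = ℕ.≤∧≢⇒< b≤d λ b≡d → distinct (refl , refl , b≡d)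
  refine {false} {true} {b = b} {d = d} a<b b<n c<d d<n (c≤a , allowed) distinct with ℕ.m≤n⇒m<n∨m≡n c≤a
  ... | inj₁ (ℕ.s≤s c≤a₀) = refinement lower-lo⁻ (ℕ.<-trans (ℕ.n<1+n _) a<b) b<n (c≤a₀ , allowed)
  ... | inj₂ refl with suc b ℕ.≟ n
  ...   | yes last = turnLast b last d<b
    where
    d<b : d ℕ.< b
    d<b = ℕ.≤∧≢⇒< (ℕ.≤-pred (subst (d ℕ.<_) (sym last) d<n)) λ d≡b → allowed (d≡b , last)
    turnLast : ∀ b → IsLast b → d ℕ.< b → Refinement false true _ b _ d
    turnLast (suc b₀) last (ℕ.s≤s d≤b₀) =
      refinement (turn-last last) (ℕ.<-≤-trans c<d d≤b₀)
        (ℕ.<-trans (ℕ.n<1+n b₀) (subst (suc b₀ ℕ.<_) last (ℕ.n<1+n _))) (c≤a , d≤b₀)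
  ...   | no notLast with suc (suc b) ℕ.≟ n | d ℕ.≟ suc b
  ...     | yes last′ | yes refl = refinement (turn-second-last last′) (ℕ.<-trans a<b (ℕ.n<1+n _)) d<n (c≤a , ℕ.≤-refl)
  ...     | no notLast′ | _ = refinement raise-hi⁻ (ℕ.<-trans a<b (ℕ.n<1+n _)) (ℕ.≤∧≢⇒< b<n notLast) (c≤a , notLast′ ∘ proj₂)
  ...     | yes _ | no d≢1+b = refinement raise-hi⁻ (ℕ.<-trans a<b (ℕ.n<1+n _)) (ℕ.≤∧≢⇒< b<n notLast) (c≤a , d≢1+b ∘ proj₁)
  refine {true} {true} {a} {b} {c} {d} a<b b<n c<d d<n (c≤a , d≤b) distinct with ℕ.m≤n⇒m<n∨m≡n d≤b | ℕ.m≤n⇒m<n∨m≡n c≤a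
  ... | _ | inj₁ (ℕ.s≤s c≤a₀) = refinement lower-lo⁺ (ℕ.<-trans (ℕ.n<1+n _) a<b) b<n (c≤a₀ , d≤b)
  ... | inj₂ refl | inj₂ refl = ⊥-elim (distinct (refl , refl , refl))
  ... | inj₁ d<b | inj₂ refl = lowerHi b d<b a<b b<n
    where
    lowerHi : ∀ b → d ℕ.< b → a ℕ.< b → b ℕ.< n → Refinement true true a b c d
    lowerHi (suc b₀) (ℕ.s≤s d≤b₀) a<b 1+b₀<n with a ℕ.<? b₀
    ... | yes a<b₀ = refinement lower-hi⁺ a<b₀ (ℕ.<-trans (ℕ.n<1+n _) 1+b₀<n) (c≤a , d≤b₀)
    ... | no a≮b₀ = ⊥-elim (a≮b₀ (ℕ.<-≤-trans c<d d≤b₀))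

  fromCoordinates : ∀ {a b} → a ℕ.< b → b ℕ.< n → Bool → Root n
  fromCoordinates a<b b<n = root (Fin.fromℕ< (ℕ.<-trans a<b b<n)) (Fin.fromℕ< b<n)
    (subst₂ ℕ._<_ (sym (Fin.toℕ-fromℕ< _)) (sym (Fin.toℕ-fromℕ< b<n)) a<b)

  depth : Root n → ℕ
  depth r = depthᶜ (plus r) (lo r) (hi r)

  Step : Root n → Root n → Set
  Step r t = Move (plus r) (lo r) (hi r) (plus t) (lo t) (hi t)

  step-depth : ∀ r t → Step r t → depth r ≡ suc (depth t)
  step-depth r t step = move-depth step (i<j r) (Fin.toℕ<n (j r)) (i<j t) (Fin.toℕ<n (j t))

  step-col : ∀ r t → Step r t → col t ≡ suc (col r) ⊎ col r ≡ suc (col t)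
  step-col r t step rewrite col-coordinates r | col-coordinates t =
    move-col step (i<j r) (Fin.toℕ<n (j r)) (i<j t) (Fin.toℕ<n (j t))

  step-≢ : ∀ r t → Step r t → r ≢ t
  step-≢ r _ step refl = ℕ.1+n≢n (sym (step-depth r r step))

  refine-root : ∀ r s → r ⊑ s → r ≢ s → ∃ λ t → Step r t × t ⊑ s
  refine-root r s r⊑s r≢s
    with refine (i<j r) (Fin.toℕ<n (j r)) (i<j s) (Fin.toℕ<n (j s)) r⊑s (λ (e₃ , e₁ , e₂) → r≢s (root-≡ e₁ e₂ e₃))
  ... | refinement {z} move a′<b′ b′<n below =
    fromCoordinates a′<b′ b′<n z , subst₂ (Move _ _ _ z) (sym (Fin.toℕ-fromℕ< _)) (sym (Fin.toℕ-fromℕ< b′<n)) move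
                    , subst₂ (λ a b → Below z _ a b _ _) (sym (Fin.toℕ-fromℕ< _)) (sym (Fin.toℕ-fromℕ< b′<n)) below

  open FinitePoset ≤R-isDecPartialOrder (allRoots n) ∈-allRoots allRoots-unique public

  cover⇒step : ∀ {r s} → Cover r s → Step r s
  cover⇒step {r} {s} ((r≤s , r≢s) , nothing-between) with refine-root r s (≤R⇒⊑ r s r≤s) r≢s
  ... | t , step , t⊑s with t ≟ᴿ s
  ...   | yes refl = step
  ...   | no t≢s =
    ⊥-elim (nothing-between (t , (⊑⇒≤R r t (move-below step) , step-≢ r t step) , (⊑⇒≤R t s t⊑s , t≢s)))

  col-coverStep : CoverStep col
  col-coverStep {r} {s} cover = step-col r s (cover⇒step cover)

  depth-coverStep : CoverStep depth
  depth-coverStep {r} {s} cover = inj₂ (step-depth r s (cover⇒step cover))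

  depth-anti : ∀ {r s} → r < s → depth s ℕ.< depth r
  depth-anti {r} {s} (r≤s , r≢s) = descend (depth r) r ℕ.≤-refl (≤R⇒⊑ r s r≤s) r≢s
    where
    descend : ∀ k r → depth r ℕ.≤ k → r ⊑ s → r ≢ s → depth s ℕ.< depth r
    descend k r dr≤k r⊑s r≢s with refine-root r s r⊑s r≢s
    ... | t , step , t⊑s with t ≟ᴿ s | k
    ...   | yes refl | _ = ℕ.≤-reflexive (sym (step-depth r t step))
    ...   | no _ | zero = ⊥-elim (ℕ.n≮0 (subst (ℕ._≤ 0) (step-depth r t step) dr≤k))
    ...   | no t≢s | suc k = ℕ.<-trans (descend k t (ℕ.≤-pred (subst (ℕ._≤ suc k) (step-depth r t step) dr≤k)) t⊑s t≢s)
                                      (ℕ.≤-reflexive (sym (step-depth r t step)))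

  pair-bound : ∀ {a b} → a ℕ.< b → b ℕ.< n → suc a + suc b ℕ.< 2 * n
  pair-bound {a} {b} a<b b<n = subst (suc a + suc b ℕ.<_) (cong (n +_) (sym (ℕ.+-identityʳ n)))
    (ℕ.≤-<-trans (ℕ.+-mono-≤ a<b b<n) (ℕ.+-monoˡ-< n b<n))

  col-bound : ∀ r → col r ℕ.< 2 * n
  col-bound (root a b a<b false) = pair-bound a<b (Fin.toℕ<n b)
  col-bound (root a b a<b true) =
    ℕ.∸-monoʳ-< (ℕ.m<n⇒0<n∸m a<b) (ℕ.≤-trans (ℕ.m∸n≤m (toℕ b) (toℕ a)) (ℕ.<⇒≤ (suc≤2n (Fin.toℕ<n b))))

  depth-bound : ∀ r → depth r ℕ.< 4 * n
  depth-bound (root a b a<b false) =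
    ℕ.+-cancelʳ-< (toℕ b) _ _ (subst (ℕ._< 4 * n + toℕ b) (sym (depthᶜ-minus (Fin.toℕ<n b))) (ℕ.+-monoʳ-< (4 * n) a<b))
  depth-bound (root a b a<b true) = subst (ℕ._< 4 * n) (sym (depthᶜ-plus (ℕ.<⇒≤ a<b) (Fin.toℕ<n b)))
    (subst₂ ℕ._<_ (shuffle (2 * n) (toℕ a) (toℕ b)) (sym (ℕ.*-distribʳ-+ n 2 2))
      (ℕ.+-monoʳ-< (2 * n) (pair-bound a<b (Fin.toℕ<n b))))
    where
    shuffle : ∀ m a b → m + (suc a + suc b) ≡ m + (a + b) + 2
    shuffle = ℕ-solve-∀

  excess : Root n → ℕ
  excess r = excessᶜ (plus r) (lo r) (hi r)

  depth≡col+2excess : ∀ r → depth r ≡ col r + 2 * excess r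
  depth≡col+2excess r = cong (_+ 2 * excess r) (sym (col-coordinates r))

  toggles-Toggles : ∀ ps {X Y} → toggles ps X ≗ Y → Toggles ps X Y
  toggles-Toggles [] X≗Y = X≗Y
  toggles-Toggles (p ∷ ps) {X} X≗Y =
    toggle p X , ((λ q → toggle-other p X) , toggle-self-true p X , toggle-self-true⁻¹ p X) , toggles-Toggles ps X≗Y

  row-Row : ∀ (I : Subset) → Row I (row I)
  row-Row I q = row-elim I {q} , row-intro I {q}

  proOrder-sweep : ∀ {X} → IsIdeal X → toggles (proOrder n) X ≗ sweep col (range 0 (4 * n)) X
  proOrder-sweep {X} isIdeal x = begin
    toggles (proOrder n) X x                                       ≡⟨ toggles-layers {col} col-coverStep (upTo (2 * n)) isIdeal x ⟩
    sweep col (upTo (2 * n)) X x                                   ≡⟨ cong (λ ts → sweep col ts X x) (applyUpTo≡range 0 (2 * n)) ⟩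
    sweep col (range 0 (2 * n)) X x                                ≡⟨ upper-layers-empty _ x ⟨
    sweep col (range (2 * n) (2 * n)) (sweep col (range 0 (2 * n)) X) x ≡⟨ cong (λ J → J x) (sweep-++ col (range 0 (2 * n)) _ X) ⟨
    sweep col (range 0 (2 * n) ++ range (2 * n) (2 * n)) X x       ≡⟨ cong (λ ts → sweep col ts X x) (range-++ 0 (2 * n) (2 * n)) ⟨
    sweep col (range 0 (2 * n + 2 * n)) X x                        ≡⟨ cong (λ m → sweep col (range 0 m) X x) (ℕ.*-distribʳ-+ n 2 2) ⟨
    sweep col (range 0 (4 * n)) X x                                ∎
    where
    open ≡-Reasoning
    beyond-col : ∀ {t} {r : Root n} → t ∈ range (2 * n) (2 * n) → col r ≢ t
    beyond-col {r = r} t∈ col≡t = ℕ.<-irrefl col≡t (ℕ.<-≤-trans (col-bound r) (proj₁ (∈-range t∈)))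
    upper-layers-empty : ∀ J → sweep col (range (2 * n) (2 * n)) J ≗ J
    upper-layers-empty J = sweep-empty col (range (2 * n) (2 * n)) J (λ {t} {r} → beyond-col {t} {r})

corollary7p1 : (n : ℕ) → 2 ≤ n →
    Σ (J n → J n) λ Φ → (((I I' : J n) → I ≈J I' → Φ I ≈J Φ I') ×
    ((I I' : J n) → Φ I ≈J Φ I' → I ≈J I') ×
    ((I' : J n) → Σ (J n) λ I → (Φ I ≈J I')) ×
    ((I : J n) → Σ (J n) λ R → (Row (proj₁ I) (proj₁ R) ×
    Pro (proj₁ (Φ I)) (proj₁ (Φ R)))))
corollary7p1 n _ = Φ , (λ _ _ → toggles⁻¹-cong w) , injective , surjective , commutes
  where
  open PositiveRoots n
  conjugacy : ∃ λ w → ∀ {I} → IsIdeal I → toggles⁻¹ w (row I) ≗ sweep col (range 0 (4 * n)) (toggles⁻¹ w I)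
  conjugacy = rowmotion-conjugate {N = 4 * n} {col} {depth} {excess}
                col-coverStep depth-coverStep depth≡col+2excess depth-bound depth-anti
  w : List (Root n)
  w = proj₁ conjugacy
  Φ : J n → J n
  Φ (I , isIdeal) = toggles⁻¹ w I , toggles⁻¹-isIdeal w isIdeal
  injective : (I I′ : J n) → Φ I ≈J Φ I′ → I ≈J I′
  injective (I , isIdeal) (I′ , isIdeal′) ΦI≗ΦI′ x =
    trans (sym (toggles-inverseˡ w isIdeal x)) (trans (toggles-cong w ΦI≗ΦI′ x) (toggles-inverseˡ w isIdeal′ x))
  surjective : (I : J n) → Σ (J n) λ I′ → Φ I′ ≈J I
  surjective (I , isIdeal) = (toggles w I , toggles-isIdeal w isIdeal) , toggles-inverseʳ w isIdeal
  commutes : (I : J n) → Σ (J n) λ R → Row (proj₁ I) (proj₁ R) × Pro (proj₁ (Φ I)) (proj₁ (Φ R))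
  commutes (I , isIdeal) = (row I , row-isIdeal I) , row-Row I , toggles-Toggles (proOrder n) λ x →
    trans (proOrder-sweep (toggles⁻¹-isIdeal w isIdeal) x) (sym (proj₂ conjugacy isIdeal x))
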